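{- Let $G$ be a connected finite simple graph, let $F$ be a connected $r$-regular graph on vertices $v_1,\dots,v_{\nu_F}$, and let $\phi:E(\vec G)\to\mathrm{Aut}(F)$ be a voltage assignment whose values lie in an abelian subgroup $\Gamma$ of $\mathrm{Aut}(F)$. Let $M_\Gamma$ be an invertible matrix such that $M_\Gamma^{ -1}P(\gamma)M_\Gamma=\mathrm{diag}(\lambda_{(\gamma,1)},\dots,\lambda_{(\gamma,\nu_F)})$ for all $\gamma\in\Gamma$ and $M_\Gamma^{ -1}A(F)M_\Gamma=\mathrm{diag}(\lambda_{(F,1)},\dots,\lambda_{(F,\nu_F)})$. For $i=1,\dots,\nu_F$ let $\omega_i(\phi)$ be the vertex-and-edge weight function on $\vec G$ given by $\omega_i(\phi)(v)=\deg_G(v)$ for $v\in V(\vec G)$ and $\omega_i(\phi)(e)=\lambda_{(\phi(e),i)}$ for $e\in E(\vec G)$. Then $$F_{G\times^\phi F}(\lambda,\mu)=\prod_{i=1}^{\nu_F}F_{\vec G_{\omega_i(\phi)}}\bigl(\lambda+r\mu-\lambda_{(F,i)},\mu\bigr).$$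
   Context: For a graph $X$, $A(X)$ is its adjacency matrix, $\mathcal{D}(X)$ its degree matrix, $F_X(\lambda,\mu)=\det(\lambda I-(A(X)-\mu\mathcal{D}(X)))$. $\vec G$ is the digraph obtained from $G$ by replacing each edge by two oppositely directed edges; a voltage assignment satisfies $\phi(e^{ -1})=\phi(e)^{ -1}$. The graph bundle $G\times^\phi F$ has vertex set $V(G)\times V(F)$ with $(u_1,v_1)\sim(u_2,v_2)$ iff either $u_1u_2\in E(\vec G)$ and $v_2=\phi(u_1u_2)(v_1)$, or $u_1=u_2$ and $v_1v_2\in E(F)$. $P(\gamma)$ is the $\nu_F\times\nu_F$ matrix with $(i,j)$-entry $1$ iff $\gamma(v_i)=v_j$; such $M_\Gamma$ exists since these matrices commute and are diagonalizable. For a digraph $D$ with vertices $w_1,\dots,w_k$ and weight function $\omega:V(D)\cup E(D)\to\mathbb{C}$, $D_\omega$ denotes the weighted digraph, $A(D_\omega)$ is the $k\times k$ matrix with $(a,b)$-entry $\sum_{e\text{ from }w_a\text{ to }w_b}\omega(e)$, $\mathcal{D}_{D_\omega}$ is the diagonal matrix with $(a,a)$-entry $\omega(w_a)$, and $F_{D_\omega}(\lambda,\mu)=\det(\lambda I-(A(D_\omega)-\mu\mathcal{D}_{D_\omega}))$. -}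

module Defs where

open import Level using (Level; _⊔_)
open import Data.Nat as ℕ using (ℕ; zero; suc)
open import Data.Bool using (Bool; true; false; if_then_else_; _∨_; _∧_)
open import Data.Fin using (Fin; zero; suc; toℕ; remQuot; _≟_)
open import Data.Fin.Permutation using (Permutation′; _⟨$⟩ʳ_; _⟨$⟩ˡ_)
open import Data.Product using (Σ; ∃; _×_; _,_)
open import Data.List using (List; []; _∷_)
open import Relation.Binary.PropositionalEquality using (_≡_)
open import Relation.Nullary.Decidable using (⌊_⌋)
open import Algebra.Bundles using (CommutativeRing)

record SimpleGraph (n : ℕ) : Set where
  field
    adj    : Fin n → Fin n → Bool
    sym    : ∀ i j → adj i j ≡ adj j i
    irrefl : ∀ i → adj i i ≡ false
open SimpleGraph public

count : ∀ {m} → (Fin m → Bool) → ℕ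
count {zero}  f = 0
count {suc m} f = (if f zero then 1 else 0) ℕ.+ count (λ i → f (suc i))

deg : ∀ {n} → SimpleGraph n → Fin n → ℕ
deg G i = count (adj G i)

data Walk {n} (G : SimpleGraph n) : Fin n → Fin n → Set where
  here : ∀ {i} → Walk G i i
  step : ∀ {i j k} → adj G i j ≡ true → Walk G j k → Walk G i k

Connected : ∀ {n} → SimpleGraph n → Set
Connected {n} G = ∀ (i j : Fin n) → Walk G i j

Regular : ∀ {n} → ℕ → SimpleGraph n → Set
Regular {n} r G = ∀ (i : Fin n) → deg G i ≡ r

IsAut : ∀ {ν} → SimpleGraph ν → Permutation′ ν → Set
IsAut {ν} F γ = ∀ (i j : Fin ν) → adj F (γ ⟨$⟩ʳ i) (γ ⟨$⟩ʳ j) ≡ adj F i j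

-- Γ (a predicate on permutations) is an abelian subgroup of Aut(F).
-- Group operations are expressed pointwise (permutations are compared
-- extensionally).
record IsAbelianSubgroupOfAut {ν} (F : SimpleGraph ν)
                              (Γ : Permutation′ ν → Set) : Set₁ where
  field
    ⊆Aut    : ∀ γ → Γ γ → IsAut F γ
    has-id  : Σ (Permutation′ ν) λ ε → Γ ε × (∀ x → ε ⟨$⟩ʳ x ≡ x)
    has-∘   : ∀ γ δ → Γ γ → Γ δ →
              Σ (Permutation′ ν) λ ε → Γ ε × (∀ x → ε ⟨$⟩ʳ x ≡ γ ⟨$⟩ʳ (δ ⟨$⟩ʳ x))
    has-inv : ∀ γ → Γ γ →
              Σ (Permutation′ ν) λ ε → Γ ε × (∀ x → ε ⟨$⟩ʳ x ≡ γ ⟨$⟩ˡ x)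
    comm    : ∀ γ δ → Γ γ → Γ δ → ∀ x → γ ⟨$⟩ʳ (δ ⟨$⟩ʳ x) ≡ δ ⟨$⟩ʳ (γ ⟨$⟩ʳ x)

-- A voltage assignment on the arcs of G⃗ with values in Γ ⊆ Aut(F).
-- The arc (u,w) of G⃗ exists iff adj G u w ≡ true; φ u w is only
-- meaningful on arcs (its values on non-arcs are never used).
record IsVoltage {n ν} (G : SimpleGraph n) (Γ : Permutation′ ν → Set)
                 (φ : Fin n → Fin n → Permutation′ ν) : Set where
  field
    inΓ : ∀ u w → adj G u w ≡ true → Γ (φ u w)
    inv : ∀ u w → adj G u w ≡ true → ∀ x → φ w u ⟨$⟩ʳ x ≡ φ u w ⟨$⟩ˡ x

bundleAdj : ∀ {n ν} → SimpleGraph n → SimpleGraph ν →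
            (Fin n → Fin n → Permutation′ ν) →
            Fin n × Fin ν → Fin n × Fin ν → Bool
bundleAdj G F φ (u₁ , v₁) (u₂ , v₂) =
  (adj G u₁ u₂ ∧ ⌊ v₂ ≟ (φ u₁ u₂ ⟨$⟩ʳ v₁) ⌋) ∨ (⌊ u₁ ≟ u₂ ⌋ ∧ adj F v₁ v₂)

bundleAdjFin : ∀ {n ν} → SimpleGraph n → SimpleGraph ν →
               (Fin n → Fin n → Permutation′ ν) →
               Fin (n ℕ.* ν) → Fin (n ℕ.* ν) → Bool
bundleAdjFin {n} {ν} G F φ a b = bundleAdj G F φ (remQuot ν a) (remQuot ν b)

-- Linear algebra over a commutative ring R (the paper works over ℂ).

module WithRing {c ℓ} (R : CommutativeRing c ℓ) where
  open CommutativeRing R public using (Carrier; _≈_; _+_; _*_; -_; _-_; 0#; 1#)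

  Matrix : ℕ → Set c
  Matrix m = Fin m → Fin m → Carrier

  _≈ᴹ_ : ∀ {m} → Matrix m → Matrix m → Set ℓ
  M ≈ᴹ N = ∀ i j → M i j ≈ N i j

  fromℕ : ℕ → Carrier
  fromℕ zero    = 0#
  fromℕ (suc k) = 1# + fromℕ k

  fromBool : Bool → Carrier
  fromBool b = if b then 1# else 0#

  Σᶠ : ∀ {m} → (Fin m → Carrier) → Carrier
  Σᶠ {zero}  f = 0#
  Σᶠ {suc m} f = f zero + Σᶠ (λ i → f (suc i))

  Πᶠ : ∀ {m} → (Fin m → Carrier) → Carrier
  Πᶠ {zero}  f = 1#
  Πᶠ {suc m} f = f zero * Πᶠ (λ i → f (suc i))

  δ : ∀ {m} → Fin m → Fin m → Carrier
  δ i j = fromBool ⌊ i ≟ j ⌋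

  I : ∀ {m} → Matrix m
  I = δ

  diag : ∀ {m} → (Fin m → Carrier) → Matrix m
  diag d i j = δ i j * d i

  _·_ : ∀ {m} → Matrix m → Matrix m → Matrix m
  (M · N) i j = Σᶠ (λ k → M i k * N k j)

  _-ᴹ_ : ∀ {m} → Matrix m → Matrix m → Matrix m
  (M -ᴹ N) i j = M i j - N i j

  _∙ᴹ_ : ∀ {m} → Carrier → Matrix m → Matrix m
  (x ∙ᴹ M) i j = x * M i j

  minor : ∀ {m} → Matrix (suc m) → Fin (suc m) → Matrix m
  minor M j a b = M (suc a) (Data.Fin.punchIn j b)

  sgn : ℕ → Carrier
  sgn zero          = 1#
  sgn (suc zero)    = - 1#
  sgn (suc (suc k)) = sgn k

  det : ∀ {m} → Matrix m → Carrier
  det {zero}  M = 1#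
  det {suc m} M = Σᶠ (λ j → sgn (toℕ j) * (M zero j * det (minor M j)))

  charF : ∀ {m} → Matrix m → Matrix m → Carrier → Carrier → Carrier
  charF A D λ' μ = det ((λ' ∙ᴹ I) -ᴹ (A -ᴹ (μ ∙ᴹ D)))

  adjMatB : ∀ {m} → (Fin m → Fin m → Bool) → Matrix m
  adjMatB e i j = fromBool (e i j)

  degMatB : ∀ {m} → (Fin m → Fin m → Bool) → Matrix m
  degMatB e = diag (λ i → fromℕ (count (e i)))

  F_ : ∀ {m} → SimpleGraph m → Carrier → Carrier → Carrier
  F_ X = charF (adjMatB (adj X)) (degMatB (adj X))

  F-bundle : ∀ {n ν} → SimpleGraph n → SimpleGraph ν →
             (Fin n → Fin n → Permutation′ ν) → Carrier → Carrier → Carrier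
  F-bundle G F φ = charF (adjMatB e) (degMatB e)
    where e = bundleAdjFin G F φ

  P : ∀ {ν} → Permutation′ ν → Matrix ν
  P γ i j = fromBool ⌊ (γ ⟨$⟩ʳ i) ≟ j ⌋

  A-weighted : ∀ {n} → SimpleGraph n → (Fin n → Fin n → Carrier) → Matrix n
  A-weighted G ωA a b = if adj G a b then ωA a b else 0#

  F-weighted : ∀ {n} → SimpleGraph n → (Fin n → Fin n → Carrier) →
               (Fin n → Carrier) → Carrier → Carrier → Carrier
  F-weighted G ωA ωV = charF (A-weighted G ωA) (diag ωV)

  F-ω : ∀ {n ν} → SimpleGraph n → (Fin n → Fin n → Permutation′ ν) →
        (Permutation′ ν → Fin ν → Carrier) → Fin ν →
        Carrier → Carrier → Carrier
  F-ω G φ λΓ i = F-weighted G (λ u w → λΓ (φ u w) i) (λ v → fromℕ (deg G v))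

-- Order the vertices of G ×^φ F as pairs (u, v). The characteristic matrix Y
-- of the bundle is then a block matrix whose (u, u′) block is a linear
-- combination of I, P(φ(u,u′)) and A(F), with scalar coefficients, since the
-- bundle is (deg_G u + r)-regular over u. Conjugating Y by I ⊗ M diagonalises
-- all these blocks at once, so that after reordering the vertices as (v, u) the
-- conjugate is block diagonal, its v-th block being the matrix of the weighted
-- digraph G⃗ with arc weights λ_(φ(e),v), shifted by r μ - λ_(F,v). The
-- determinant facts this needs (multiplicativity, invariance under simultaneous
-- row and column permutation, the block-diagonal rule) follow, over any
-- commutative ring, from f A ≈ det A * f I for every alternating multilinear f.
module Submission where

open import Defs hiding (sym)
open import Algebra.Bundles using (CommutativeRing)
open import Algebra.Solver.Ring.AlmostCommutativeRing
  using (fromCommutativeRing; _-Raw-AlmostCommutative⟶_)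
open import Data.Bool using (Bool; true; false; if_then_else_; _∧_; _∨_)
open import Data.Bool.Properties using (∧-conicalˡ)
open import Data.Fin as Fin using (Fin; zero; suc; _≟_; _↑ˡ_; _↑ʳ_; combine; toℕ; punchIn; inject₁)
import Data.Fin.Properties as Fin
open import Data.Fin.Induction using (<-weakInduction)
open import Data.Fin.Permutation as Perm using (Permutation; Permutation′; _⟨$⟩ʳ_; _⟨$⟩ˡ_)
open import Data.Integer as ℤ using (ℤ; +_; -[1+_]; _⊖_)
import Data.Integer.Properties as ℤ
open import Data.Maybe as Maybe using (Maybe)
open import Data.Nat as ℕ using (ℕ; zero; suc)
import Data.Nat.Properties as ℕ
open import Data.Product using (_×_; _,_; proj₁; proj₂; swap; uncurry)
open import Data.Product.Algebra using (×-comm)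
open import Data.Sum using (_⊎_; inj₁; inj₂; [_,_]′)
open import Data.Unit.Polymorphic using (⊤; tt)
open import Data.Vec.Functional using (updateAt; insertAt; removeAt)
open import Data.Vec.Functional.Properties
  using (updateAt-updates; updateAt-minimal; insertAt-lookup; insertAt-punchIn)
open import Function using (_∘_; _$_; const)
open import Function.Construct.Composition using (_↔-∘_)
open import Function.Construct.Symmetry using (↔-sym)
open import Function.Definitions using (Injective)
open import Level using (_⊔_)
open import Relation.Binary.Consequences using (dec⇒weaklyDec)
open import Relation.Binary.PropositionalEquality as ≡ using (_≡_; _≢_)
import Relation.Binary.Reasoning.Setoid as SetoidReasoning
open import Relation.Nullary using (yes; no; does; ¬_; contradiction)
open import Relation.Nullary.Decidable using (⌊_⌋; dec-true; dec-false; isYes≗does)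

≟-true : ∀ {m} {i j : Fin m} → i ≡ j → ⌊ i ≟ j ⌋ ≡ true
≟-true {i = i} {j} i≡j = ≡.trans (isYes≗does (i ≟ j)) (dec-true (i ≟ j) i≡j)

≟-false : ∀ {m} {i j : Fin m} → i ≢ j → ⌊ i ≟ j ⌋ ≡ false
≟-false {i = i} {j} i≢j = ≡.trans (isYes≗does (i ≟ j)) (dec-false (i ≟ j) i≢j)

-- The ring solvers of the library need coefficients with (weakly) decidable
-- equality; ℤ, mapped into R, provides them.
module IntegerCoefficientSolver {c ℓ} (R : CommutativeRing c ℓ) where
  open CommutativeRing R
  open import Algebra.Properties.Ring ring
    using (-‿involutive; -‿+-comm; -0#≈0#; -‿distribˡ-*; -‿distribʳ-*)
  open import Algebra.Properties.Semiring.Mult.TCOptimised semiring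
    using (1+×; ×-homo-+; ×1-homo-*) renaming (_×_ to _×′_)
  open import Algebra.Properties.CommutativeSemigroup +-commutativeSemigroup
    using (interchange)
  open import Relation.Binary.Reasoning.Setoid setoid

  -- This _×′_ satisfies 1 ×′ x = x definitionally, so the solver's constants
  -- + 0 and + 1 denote 0# and 1# on the nose.
  fromℤ : ℤ → Carrier
  fromℤ (+ n)    = n ×′ 1#
  fromℤ -[1+ n ] = - (suc n ×′ 1#)

  fromℤ-⊖ : ∀ m n → fromℤ (m ⊖ n) ≈ m ×′ 1# + - (n ×′ 1#)
  fromℤ-⊖ zero    zero    = sym (trans (+-identityˡ _) -0#≈0#)
  fromℤ-⊖ zero    (suc n) = sym (+-identityˡ _)
  fromℤ-⊖ (suc m) zero    = sym (trans (+-congˡ -0#≈0#) (+-identityʳ _))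
  fromℤ-⊖ (suc m) (suc n) = begin
    fromℤ (suc m ⊖ suc n)                  ≡⟨ ≡.cong fromℤ (ℤ.[1+m]⊖[1+n]≡m⊖n m n) ⟩
    fromℤ (m ⊖ n)                          ≈⟨ fromℤ-⊖ m n ⟩
    m ×′ 1# + - (n ×′ 1#)                  ≈⟨ +-identityˡ _ ⟨
    0# + (m ×′ 1# + - (n ×′ 1#))           ≈⟨ +-congʳ (-‿inverseʳ 1#) ⟨
    (1# + - 1#) + (m ×′ 1# + - (n ×′ 1#))  ≈⟨ interchange _ _ _ _ ⟩
    (1# + m ×′ 1#) + (- 1# + - (n ×′ 1#))  ≈⟨ +-cong (1+× m 1#) (trans (-‿cong (1+× n 1#)) (sym (-‿+-comm 1# _))) ⟨
    suc m ×′ 1# + - (suc n ×′ 1#) ∎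

  fromℤ-+ : ∀ i j → fromℤ (i ℤ.+ j) ≈ fromℤ i + fromℤ j
  fromℤ-+ (+ m)    (+ n)    = ×-homo-+ 1# m n
  fromℤ-+ (+ m)    -[1+ n ] = fromℤ-⊖ m (suc n)
  fromℤ-+ -[1+ m ] (+ n)    = trans (fromℤ-⊖ n (suc m)) (+-comm _ _)
  fromℤ-+ -[1+ m ] -[1+ n ] = begin
    - (suc (suc (m ℕ.+ n)) ×′ 1#)  ≡⟨ ≡.cong (λ k → - (suc k ×′ 1#)) (ℕ.+-suc m n) ⟨
    - ((suc m ℕ.+ suc n) ×′ 1#)    ≈⟨ -‿cong (×-homo-+ 1# (suc m) (suc n)) ⟩
    - (suc m ×′ 1# + suc n ×′ 1#)  ≈⟨ -‿+-comm _ _ ⟨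
    - (suc m ×′ 1#) + - (suc n ×′ 1#) ∎

  fromℤ-neg : ∀ i → fromℤ (ℤ.- i) ≈ - fromℤ i
  fromℤ-neg (+ zero)  = sym -0#≈0#
  fromℤ-neg (+ suc n) = refl
  fromℤ-neg -[1+ n ]  = sym (-‿involutive _)

  fromℤ-*-+ : ∀ m n → fromℤ (+ m ℤ.* + n) ≈ m ×′ 1# * n ×′ 1#
  fromℤ-*-+ m n = trans (reflexive (≡.cong fromℤ (≡.sym (ℤ.pos-* m n)))) (×1-homo-* m n)

  fromℤ-* : ∀ i j → fromℤ (i ℤ.* j) ≈ fromℤ i * fromℤ j
  fromℤ-* (+ m) (+ n) = fromℤ-*-+ m n
  fromℤ-* (+ m) -[1+ n ] = begin
    fromℤ (+ m ℤ.* -[1+ n ])       ≡⟨ ≡.cong fromℤ (ℤ.neg-distribʳ-* (+ m) (+ suc n)) ⟨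
    fromℤ (ℤ.- (+ m ℤ.* + suc n))  ≈⟨ fromℤ-neg (+ m ℤ.* + suc n) ⟩
    - fromℤ (+ m ℤ.* + suc n)      ≈⟨ -‿cong (fromℤ-*-+ m (suc n)) ⟩
    - (m ×′ 1# * suc n ×′ 1#)      ≈⟨ -‿distribʳ-* _ _ ⟩
    m ×′ 1# * - (suc n ×′ 1#) ∎
  fromℤ-* -[1+ m ] (+ n) = begin
    fromℤ (-[1+ m ] ℤ.* + n)       ≡⟨ ≡.cong fromℤ (ℤ.neg-distribˡ-* (+ suc m) (+ n)) ⟨
    fromℤ (ℤ.- (+ suc m ℤ.* + n))  ≈⟨ fromℤ-neg (+ suc m ℤ.* + n) ⟩
    - fromℤ (+ suc m ℤ.* + n)      ≈⟨ -‿cong (fromℤ-*-+ (suc m) n) ⟩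
    - (suc m ×′ 1# * n ×′ 1#)      ≈⟨ -‿distribˡ-* _ _ ⟩
    - (suc m ×′ 1#) * n ×′ 1# ∎
  fromℤ-* -[1+ m ] -[1+ n ] = begin
    fromℤ (+ suc m ℤ.* + suc n)        ≈⟨ fromℤ-*-+ (suc m) (suc n) ⟩
    suc m ×′ 1# * suc n ×′ 1#          ≈⟨ -‿involutive _ ⟨
    - - (suc m ×′ 1# * suc n ×′ 1#)    ≈⟨ -‿cong (-‿distribˡ-* _ _) ⟩
    - (- (suc m ×′ 1#) * suc n ×′ 1#)  ≈⟨ -‿distribʳ-* _ _ ⟩
    - (suc m ×′ 1#) * - (suc n ×′ 1#) ∎

  fromℤ-homomorphism : ℤ.+-*-rawRing -Raw-AlmostCommutative⟶ fromCommutativeRing R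
  fromℤ-homomorphism = record
    { ⟦_⟧ = fromℤ ; +-homo = fromℤ-+ ; *-homo = fromℤ-* ; -‿homo = fromℤ-neg
    ; 0-homo = refl ; 1-homo = refl }

  fromℤ-weaklyDecidable : ∀ i j → Maybe (fromℤ i ≈ fromℤ j)
  fromℤ-weaklyDecidable i j = Maybe.map (λ { ≡.refl → refl }) (dec⇒weaklyDec ℤ._≟_ i j)

  open import Algebra.Solver.Ring ℤ.+-*-rawRing (fromCommutativeRing R)
    fromℤ-homomorphism fromℤ-weaklyDecidable public

module LinearAlgebra {c ℓ} (R : CommutativeRing c ℓ) where
  open WithRing R
  open CommutativeRing R hiding (Carrier; _≈_; _+_; _*_; -_; _-_; 0#; 1#; zero)
  open import Algebra.Properties.Ring ring using (-‿+-comm; -0#≈0#; -‿involutive; -‿distribˡ-*)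
  open import Algebra.Properties.Group +-group using (inverseʳ-unique)
  open import Algebra.Properties.CommutativeSemigroup +-commutativeSemigroup
    using (interchange)
  open IntegerCoefficientSolver R using (solve; _:+_; _:*_; :-_; _:-_; _:=_; con; Polynomial)
  open import Relation.Binary.Reasoning.Setoid setoid

  0ᴾ 1ᴾ : ∀ {k} → Polynomial k
  0ᴾ = con (+ 0)
  1ᴾ = con (+ 1)

  Σᶠ-cong : ∀ {m} {f g : Fin m → Carrier} → (∀ i → f i ≈ g i) → Σᶠ f ≈ Σᶠ g
  Σᶠ-cong {zero}  f≈g = refl
  Σᶠ-cong {suc m} f≈g = +-cong (f≈g zero) (Σᶠ-cong (f≈g ∘ suc))

  Σᶠ-zero : ∀ {m} {f : Fin m → Carrier} → (∀ i → f i ≈ 0#) → Σᶠ f ≈ 0#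
  Σᶠ-zero {zero}  f≈0 = refl
  Σᶠ-zero {suc m} f≈0 = trans (+-cong (f≈0 zero) (Σᶠ-zero (f≈0 ∘ suc))) (+-identityʳ 0#)

  Σᶠ-head : ∀ {m} (f : Fin (suc m) → Carrier) → (∀ i → f (suc i) ≈ 0#) → Σᶠ f ≈ f zero
  Σᶠ-head f tail≈0 = trans (+-congˡ (Σᶠ-zero tail≈0)) (+-identityʳ _)

  Σᶠ-distrib-+ : ∀ {m} (f g : Fin m → Carrier) → Σᶠ (λ i → f i + g i) ≈ Σᶠ f + Σᶠ g
  Σᶠ-distrib-+ {zero}  f g = sym (+-identityʳ 0#)
  Σᶠ-distrib-+ {suc m} f g =
    trans (+-congˡ (Σᶠ-distrib-+ (f ∘ suc) (g ∘ suc))) (interchange _ _ _ _)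

  Σᶠ-neg : ∀ {m} (f : Fin m → Carrier) → Σᶠ (λ i → - f i) ≈ - Σᶠ f
  Σᶠ-neg {zero}  f = sym -0#≈0#
  Σᶠ-neg {suc m} f = trans (+-congˡ (Σᶠ-neg (f ∘ suc))) (-‿+-comm _ _)

  *-distribˡ-Σᶠ : ∀ {m} x (f : Fin m → Carrier) → x * Σᶠ f ≈ Σᶠ (λ i → x * f i)
  *-distribˡ-Σᶠ {zero}  x f = zeroʳ x
  *-distribˡ-Σᶠ {suc m} x f = trans (distribˡ x _ _) (+-congˡ (*-distribˡ-Σᶠ x (f ∘ suc)))

  *-distribʳ-Σᶠ : ∀ {m} x (f : Fin m → Carrier) → Σᶠ f * x ≈ Σᶠ (λ i → f i * x)
  *-distribʳ-Σᶠ {zero}  x f = zeroˡ x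
  *-distribʳ-Σᶠ {suc m} x f = trans (distribʳ x _ _) (+-congˡ (*-distribʳ-Σᶠ x (f ∘ suc)))

  Σᶠ-linear : ∀ {m} x y {f g h : Fin m → Carrier} → (∀ i → f i ≈ x * g i + y * h i) →
              Σᶠ f ≈ x * Σᶠ g + y * Σᶠ h
  Σᶠ-linear {m} x y {f} {g} {h} f≈ = begin
    Σᶠ f                                     ≈⟨ Σᶠ-cong f≈ ⟩
    Σᶠ (λ i → x * g i + y * h i)             ≈⟨ Σᶠ-distrib-+ {m} _ _ ⟩
    Σᶠ (λ i → x * g i) + Σᶠ (λ i → y * h i)  ≈⟨ +-cong (*-distribˡ-Σᶠ x g) (*-distribˡ-Σᶠ y h) ⟨
    x * Σᶠ g + y * Σᶠ h                      ∎

  Σᶠ-↑ : ∀ p {q} (f : Fin (p ℕ.+ q) → Carrier) →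
         Σᶠ f ≈ Σᶠ (λ i → f (i ↑ˡ q)) + Σᶠ (λ i → f (p ↑ʳ i))
  Σᶠ-↑ zero    f = sym (+-identityˡ _)
  Σᶠ-↑ (suc p) f = trans (+-congˡ (Σᶠ-↑ p (f ∘ suc))) (sym (+-assoc _ _ _))

  Σᶠ-combine : ∀ m {n} (f : Fin (m ℕ.* n) → Carrier) →
               Σᶠ f ≈ Σᶠ {m} (λ u → Σᶠ {n} (λ v → f (combine u v)))
  Σᶠ-combine zero        f = refl
  Σᶠ-combine (suc m) {n} f = trans (Σᶠ-↑ n {m ℕ.* n} f) (+-congˡ (Σᶠ-combine m {n} (λ k → f (n ↑ʳ k))))

  δ-≡ : ∀ {m} {i j : Fin m} → i ≡ j → δ i j ≡ 1#
  δ-≡ i≡j = ≡.cong fromBool (≟-true i≡j)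

  δ-≢ : ∀ {m} {i j : Fin m} → i ≢ j → δ i j ≡ 0#
  δ-≢ i≢j = ≡.cong fromBool (≟-false i≢j)

  δ-injective : ∀ {m k} (f : Fin m → Fin k) → Injective _≡_ _≡_ f → ∀ a b → δ (f a) (f b) ≡ δ a b
  δ-injective f f-inj a b with a ≟ b
  ... | yes a≡b = δ-≡ (≡.cong f a≡b)
  ... | no  a≢b = δ-≢ (a≢b ∘ f-inj)

  δ-sym : ∀ {m} (i j : Fin m) → δ i j ≡ δ j i
  δ-sym i j with i ≟ j
  ... | yes i≡j = ≡.sym (δ-≡ (≡.sym i≡j))
  ... | no  i≢j = ≡.sym (δ-≢ (i≢j ∘ ≡.sym))

  δ-suc : ∀ {m} (a b : Fin m) → δ (suc a) (suc b) ≈ δ a b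
  δ-suc a b = reflexive (δ-injective suc Fin.suc-injective a b)

  Σᶠ-δˡ : ∀ {m} (i : Fin m) (f : Fin m → Carrier) → Σᶠ (λ j → δ i j * f j) ≈ f i
  Σᶠ-δˡ zero    f = trans (Σᶠ-head (λ j → δ zero j * f j) (λ _ → zeroˡ _)) (*-identityˡ _)
  Σᶠ-δˡ (suc i) f = trans (+-cong (zeroˡ _) (Σᶠ-cong (λ j → *-congʳ (δ-suc i j))))
                          (trans (+-identityˡ _) (Σᶠ-δˡ i (f ∘ suc)))

  Σᶠ-δʳ : ∀ {m} (i : Fin m) (f : Fin m → Carrier) → Σᶠ (λ j → f j * δ j i) ≈ f i
  Σᶠ-δʳ i f = trans (Σᶠ-cong (λ j → trans (*-comm (f j) _) (*-congʳ (reflexive (δ-sym j i))))) (Σᶠ-δˡ i f)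

  δ-combine : ∀ {m n} (u u′ : Fin m) (v v′ : Fin n) →
              δ (combine u v) (combine u′ v′) ≈ δ u u′ * δ v v′
  δ-combine u u′ v v′ with u ≟ u′ | v ≟ v′
  ... | yes ≡.refl | yes ≡.refl = trans (reflexive (δ-≡ ≡.refl)) (sym (*-identityˡ 1#))
  ... | yes ≡.refl | no v≢v′ =
    trans (reflexive (δ-≢ (v≢v′ ∘ proj₂ ∘ Fin.combine-injective u v u v′))) (sym (zeroʳ _))
  ... | no u≢u′ | _ =
    trans (reflexive (δ-≢ (u≢u′ ∘ proj₁ ∘ Fin.combine-injective u v u′ v′))) (sym (zeroˡ _))

  ·-cong : ∀ {m} {A A′ B B′ : Matrix m} → A ≈ᴹ A′ → B ≈ᴹ B′ → (A · B) ≈ᴹ (A′ · B′)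
  ·-cong A≈ B≈ i j = Σᶠ-cong (λ k → *-cong (A≈ i k) (B≈ k j))

  ·-identityˡ : ∀ {m} (A : Matrix m) → (I · A) ≈ᴹ A
  ·-identityˡ A i j = Σᶠ-δˡ i (λ k → A k j)

  ·-identityʳ : ∀ {m} (A : Matrix m) → (A · I) ≈ᴹ A
  ·-identityʳ A i j = Σᶠ-δʳ j (A i)

  sgnᶠ : ∀ {m} → Fin m → Carrier
  sgnᶠ j = sgn (toℕ j)

  sgn-suc : ∀ k → sgn (suc k) ≈ - sgn k
  sgn-suc zero          = refl
  sgn-suc (suc zero)    = sym (-‿involutive 1#)
  sgn-suc (suc (suc k)) = sgn-suc k

  laplaceTerm : ∀ {m} → Matrix (suc m) → Fin (suc m) → Carrier
  laplaceTerm A j = sgnᶠ j * (A zero j * det (minor A j))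

  det-cong : ∀ {m} {A B : Matrix m} → A ≈ᴹ B → det A ≈ det B
  det-cong {zero}          A≈B = refl
  det-cong {suc m} {A} {B} A≈B = Σᶠ-cong {f = laplaceTerm A} {g = laplaceTerm B} λ j →
    *-congˡ (*-cong (A≈B zero j) (det-cong (λ a b → A≈B (suc a) (punchIn j b))))

  det-identity : ∀ {m} → det (I {m}) ≈ 1#
  det-identity {zero}  = refl
  det-identity {suc m} = begin
    det (I {suc m})                  ≈⟨ Σᶠ-head (laplaceTerm (I {suc m}))
                                                 (λ _ → trans (*-congˡ (zeroˡ _)) (zeroʳ _)) ⟩
    1# * (1# * det (minor (I {suc m}) zero))
                                     ≈⟨ trans (*-identityˡ _) (*-identityˡ _) ⟩
    det (minor (I {suc m}) zero)     ≈⟨ det-cong {A = minor I zero} {B = I {m}} δ-suc ⟩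
    det (I {m})                      ≈⟨ det-identity {m} ⟩
    1#                               ∎

  -- Alternating multilinear forms

  AgreeOffRow : ∀ {m} → Fin m → Matrix m → Matrix m → Set ℓ
  AgreeOffRow a A B = ∀ i → i ≢ a → ∀ j → A i j ≈ B i j

  record IsAlternatingMultilinear {m} (f : Matrix m → Carrier) : Set (c ⊔ ℓ) where
    field
      cong        : ∀ {A B} → A ≈ᴹ B → f A ≈ f B
      linear      : ∀ a x y (A B C : Matrix m) → AgreeOffRow a A B → AgreeOffRow a A C →
                    (∀ j → A a j ≈ x * B a j + y * C a j) → f A ≈ x * f B + y * f C
      alternating : ∀ {a b} (A : Matrix m) → a ≢ b → (∀ j → A a j ≈ A b j) → f A ≈ 0#

    additive : ∀ a (A B C : Matrix m) → AgreeOffRow a A B → AgreeOffRow a A C →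
               (∀ j → A a j ≈ B a j + C a j) → f A ≈ f B + f C
    additive a A B C A~B A~C row = trans
      (linear a 1# 1# A B C A~B A~C (λ j → trans (row j) (sym (+-cong (*-identityˡ _) (*-identityˡ _)))))
      (+-cong (*-identityˡ _) (*-identityˡ _))

  setRow : ∀ {m} → Matrix m → Fin m → (Fin m → Carrier) → Matrix m
  setRow A a v = updateAt A a (const v)

  setRow-updates : ∀ {m} (A : Matrix m) a v j → setRow A a v a j ≈ v j
  setRow-updates A a v j = reflexive (≡.cong (_$ j) (updateAt-updates a A))

  setRow-minimal : ∀ {m} (A : Matrix m) {a} v {i} j → i ≢ a → setRow A a v i j ≈ A i j
  setRow-minimal A {a} v {i} j i≢a = reflexive (≡.cong (_$ j) (updateAt-minimal i a A i≢a))

  setRow-agreeOffRow : ∀ {m} (A : Matrix m) a v w → AgreeOffRow a (setRow A a v) (setRow A a w)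
  setRow-agreeOffRow A a v w i i≢a j = trans (setRow-minimal A v j i≢a) (sym (setRow-minimal A w j i≢a))

  module _ {m} {f : Matrix m → Carrier} (form : IsAlternatingMultilinear f) where
    open IsAlternatingMultilinear form

    -- With s = A a + A b in both rows a and b, f vanishes; expanding it
    -- bilinearly in these two rows leaves f A + f B.
    swapRows-negates : ∀ {a b} → a ≢ b → (A B : Matrix m) →
                       (∀ j → B a j ≈ A b j) → (∀ j → B b j ≈ A a j) →
                       (∀ i → i ≢ a → i ≢ b → ∀ j → B i j ≈ A i j) → f B ≈ - f A
    swapRows-negates {a} {b} a≢b A B Ba Bb Bi = inverseʳ-unique (f A) (f B) sum≈0
      where
      g : (Fin m → Carrier) → (Fin m → Carrier) → Carrier
      g v w = f (setRow (setRow A a v) b w)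

      row-a : ∀ v w j → setRow (setRow A a v) b w a j ≈ v j
      row-a v w j = trans (setRow-minimal _ w j a≢b) (setRow-updates A a v j)

      g-diagonal : ∀ v → g v v ≈ 0#
      g-diagonal v = alternating _ a≢b (λ j → trans (row-a v v j) (sym (setRow-updates _ b v j)))

      g-additiveˡ : ∀ u u′ w → g (λ j → u j + u′ j) w ≈ g u w + g u′ w
      g-additiveˡ u u′ w = additive a _ _ _ (agree u) (agree u′)
        (λ j → trans (row-a _ w j) (sym (+-cong (row-a u w j) (row-a u′ w j))))
        where
        agree : ∀ u″ → AgreeOffRow a (setRow (setRow A a (λ j → u j + u′ j)) b w) (setRow (setRow A a u″) b w)
        agree u″ i i≢a j with i ≟ b
        ... | yes ≡.refl = trans (setRow-updates _ b w j) (sym (setRow-updates _ b w j))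
        ... | no  i≢b = trans (setRow-minimal _ w j i≢b)
                          (trans (setRow-agreeOffRow A a _ u″ i i≢a j) (sym (setRow-minimal _ w j i≢b)))

      g-additiveʳ : ∀ v w w′ → g v (λ j → w j + w′ j) ≈ g v w + g v w′
      g-additiveʳ v w w′ = additive b _ _ _
        (setRow-agreeOffRow _ b _ w) (setRow-agreeOffRow _ b _ w′)
        (λ j → trans (setRow-updates _ b _ j) (sym (+-cong (setRow-updates _ b w j) (setRow-updates _ b w′ j))))

      g-realises : ∀ v w (C : Matrix m) → (∀ j → C a j ≈ v j) → (∀ j → C b j ≈ w j) →
                   (∀ i → i ≢ a → i ≢ b → ∀ j → C i j ≈ A i j) → g v w ≈ f C
      g-realises v w C Ca Cb Ci = cong λ i j → entry i j
        where
        entry : ∀ i j → setRow (setRow A a v) b w i j ≈ C i j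
        entry i j with i ≟ b | i ≟ a
        ... | yes ≡.refl | _          = trans (setRow-updates _ b w j) (sym (Cb j))
        ... | no  i≢b    | yes ≡.refl = trans (row-a v w j) (sym (Ca j))
        ... | no  i≢b    | no  i≢a    =
          trans (setRow-minimal _ w j i≢b) (trans (setRow-minimal A v j i≢a) (sym (Ci i i≢a i≢b j)))

      sum≈0 : f A + f B ≈ 0#
      sum≈0 = begin
        f A + f B                                 ≈⟨ +-cong (+-identityˡ _) (+-identityʳ _) ⟨
        (0# + f A) + (f B + 0#)                   ≈⟨ +-cong (+-cong (g-diagonal (A a)) fA) (+-cong fB (g-diagonal (A b))) ⟨
        (g (A a) (A a) + g (A a) (A b)) + (g (A b) (A a) + g (A b) (A b))
                                                  ≈⟨ +-cong (g-additiveʳ (A a) _ _) (g-additiveʳ (A b) _ _) ⟨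
        g (A a) s + g (A b) s                     ≈⟨ g-additiveˡ (A a) (A b) s ⟨
        g s s                                     ≈⟨ g-diagonal s ⟩
        0#                                        ∎
        where
        s : Fin m → Carrier
        s j = A a j + A b j
        fA : g (A a) (A b) ≈ f A
        fA = g-realises _ _ A (λ _ → refl) (λ _ → refl) (λ _ _ _ _ → refl)
        fB : g (A b) (A a) ≈ f B
        fB = g-realises _ _ B Ba Bb Bi

  minor-agreeOffRow : ∀ {m} {a} {A B : Matrix (suc m)} → AgreeOffRow (suc a) A B →
                      ∀ j → AgreeOffRow a (minor A j) (minor B j)
  minor-agreeOffRow A~B j i i≢a b = A~B (suc i) (i≢a ∘ Fin.suc-injective) (punchIn j b)

  det-linear : ∀ {m} a x y (A B C : Matrix m) → AgreeOffRow a A B → AgreeOffRow a A C →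
               (∀ j → A a j ≈ x * B a j + y * C a j) → det A ≈ x * det B + y * det C
  det-linear {suc m} zero x y A B C A~B A~C row =
    Σᶠ-linear x y {laplaceTerm A} {laplaceTerm B} {laplaceTerm C} λ j → begin
      sgnᶠ j * (A zero j * det (minor A j))
        ≈⟨ *-congˡ (*-congʳ (row j)) ⟩
      sgnᶠ j * ((x * B zero j + y * C zero j) * det (minor A j))
        ≈⟨ solve 6 (λ s x y b c d → s :* ((x :* b :+ y :* c) :* d) := x :* (s :* (b :* d)) :+ y :* (s :* (c :* d)))
                 refl (sgnᶠ j) x y (B zero j) (C zero j) (det (minor A j)) ⟩
      x * (sgnᶠ j * (B zero j * det (minor A j))) + y * (sgnᶠ j * (C zero j * det (minor A j)))
        ≈⟨ +-cong (*-congˡ (*-congˡ (*-congˡ (det-cong (minor≈ A~B j)))))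
                  (*-congˡ (*-congˡ (*-congˡ (det-cong (minor≈ A~C j))))) ⟩
      x * laplaceTerm B j + y * laplaceTerm C j ∎
    where
    minor≈ : ∀ {D} → AgreeOffRow zero A D → ∀ j → minor A j ≈ᴹ minor D j
    minor≈ A~D j a b = A~D (suc a) (λ ()) (punchIn j b)
  det-linear {suc m} (suc a) x y A B C A~B A~C row =
    Σᶠ-linear x y {laplaceTerm A} {laplaceTerm B} {laplaceTerm C} λ j → begin
      sgnᶠ j * (A zero j * det (minor A j))
        ≈⟨ *-congˡ (*-congˡ (det-linear a x y (minor A j) (minor B j) (minor C j)
                     (minor-agreeOffRow A~B j) (minor-agreeOffRow A~C j) (row ∘ punchIn j))) ⟩
      sgnᶠ j * (A zero j * (x * det (minor B j) + y * det (minor C j)))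
        ≈⟨ solve 6 (λ s x y a b c → s :* (a :* (x :* b :+ y :* c)) := x :* (s :* (a :* b)) :+ y :* (s :* (a :* c)))
                 refl (sgnᶠ j) x y (A zero j) (det (minor B j)) (det (minor C j)) ⟩
      x * (sgnᶠ j * (A zero j * det (minor B j))) + y * (sgnᶠ j * (A zero j * det (minor C j)))
        ≈⟨ +-cong (*-congˡ (*-congˡ (*-congʳ (A~B zero (λ ()) j))))
                  (*-congˡ (*-congˡ (*-congʳ (A~C zero (λ ()) j)))) ⟩
      x * laplaceTerm B j + y * laplaceTerm C j ∎

  -- Read D j k as a function of the column pair {j , punchIn j k}; this says it
  -- only depends on the unordered pair.
  PairSymmetric : ∀ q → (Fin (suc q) → Fin q → Carrier) → Set ℓ
  PairSymmetric zero    D = ⊤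
  PairSymmetric (suc q) D =
    (∀ k → D zero k ≈ D (suc k) zero) × PairSymmetric q (λ j k → D (suc j) (suc k))

  PairSymmetric-cong : ∀ q {D E : Fin (suc q) → Fin q → Carrier} →
                       (∀ j k → D j k ≈ E j k) → PairSymmetric q D → PairSymmetric q E
  PairSymmetric-cong zero    D≈E _            = tt
  PairSymmetric-cong (suc q) D≈E (D0 , Dsuc) =
    (λ k → trans (sym (D≈E zero k)) (trans (D0 k) (D≈E (suc k) zero))) ,
    PairSymmetric-cong q (λ j k → D≈E (suc j) (suc k)) Dsuc

  selection-pairSymmetric : ∀ q (Φ : (Fin q → Fin (suc (suc q))) → Carrier) →
    (∀ s t → (∀ i → s i ≡ t i) → Φ s ≈ Φ t) →
    PairSymmetric (suc q) (λ j k → Φ (punchIn j ∘ punchIn k))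
  selection-pairSymmetric zero    Φ Φ-cong = (λ _ → refl) , tt
  selection-pairSymmetric (suc q) Φ Φ-cong = (λ _ → refl) ,
    PairSymmetric-cong (suc q) (λ j k → Φ-cong _ _ (lift-punchIn j k))
      (selection-pairSymmetric q (Φ ∘ Fin.lift 1) (λ s t s≗t → Φ-cong _ _ (lift-cong s≗t)))
    where
    lift-punchIn : ∀ j k i → Fin.lift 1 (punchIn j ∘ punchIn k) i ≡ punchIn (suc j) (punchIn (suc k) i)
    lift-punchIn j k zero    = ≡.refl
    lift-punchIn j k (suc i) = ≡.refl
    lift-cong : ∀ {s t : Fin q → Fin (suc (suc q))} → (∀ i → s i ≡ t i) → ∀ i → Fin.lift 1 s i ≡ Fin.lift 1 t i
    lift-cong s≗t zero    = ≡.refl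
    lift-cong s≗t (suc i) = ≡.cong suc (s≗t i)

  -- The (j , k) term of the Laplace expansion along the first two rows, when both rows are x.
  doubleLaplaceTerm : ∀ {q} → (Fin (suc q) → Carrier) → (Fin (suc q) → Fin q → Carrier) →
                      Fin (suc q) → Fin q → Carrier
  doubleLaplaceTerm x D j k = (sgnᶠ j * sgnᶠ k) * ((x j * x (punchIn j k)) * D j k)

  -- The terms (0 , k) and (suc k , 0) cancel; the rest is the same sum one size down.
  doubleLaplace-vanishes : ∀ q x D → PairSymmetric q D →
                           Σᶠ (λ j → Σᶠ (λ k → doubleLaplaceTerm x D j k)) ≈ 0#
  doubleLaplace-vanishes zero    x D _            = +-identityʳ 0#
  doubleLaplace-vanishes (suc q) x D (D0 , Dsuc) = begin
    Σᶠ (T zero) + Σᶠ (λ j → T (suc j) zero + Σᶠ (λ k → T (suc j) (suc k)))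
      ≈⟨ +-congˡ (Σᶠ-distrib-+ (λ j → T (suc j) zero) (λ j → Σᶠ (λ k → T (suc j) (suc k)))) ⟩
    Σᶠ (T zero) + (Σᶠ (λ j → T (suc j) zero) + Σᶠ (λ j → Σᶠ (λ k → T (suc j) (suc k))))
      ≈⟨ +-assoc _ _ _ ⟨
    (Σᶠ (T zero) + Σᶠ (λ j → T (suc j) zero)) + Σᶠ (λ j → Σᶠ (λ k → T (suc j) (suc k)))
      ≈⟨ +-cong (trans (sym (Σᶠ-distrib-+ (T zero) (λ k → T (suc k) zero))) (Σᶠ-zero {suc q} pairs-cancel))
                (trans (Σᶠ-cong (λ j → Σᶠ-cong (λ k → shift j k)))
                       (doubleLaplace-vanishes q (x ∘ suc) (λ j k → D (suc j) (suc k)) Dsuc)) ⟩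
    0# + 0#
      ≈⟨ +-identityʳ 0# ⟩
    0# ∎
    where
    T : Fin (suc (suc q)) → Fin (suc q) → Carrier
    T = doubleLaplaceTerm x D
    pairs-cancel : ∀ k → T zero k + T (suc k) zero ≈ 0#
    pairs-cancel k = begin
      (1# * sgnᶠ k) * ((x zero * x (suc k)) * D zero k) + (sgnᶠ (suc k) * 1#) * ((x (suc k) * x zero) * D (suc k) zero)
        ≈⟨ +-congˡ (*-cong (*-congʳ (sgn-suc (toℕ k))) (*-congˡ (sym (D0 k)))) ⟩
      (1# * sgnᶠ k) * ((x zero * x (suc k)) * D zero k) + (- sgnᶠ k * 1#) * ((x (suc k) * x zero) * D zero k)
        ≈⟨ solve 4 (λ s a b d → (1ᴾ :* s) :* ((a :* b) :* d) :+ (:- s :* 1ᴾ) :* ((b :* a) :* d) := 0ᴾ)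
                 refl (sgnᶠ k) (x zero) (x (suc k)) (D zero k) ⟩
      0# ∎
    shift : ∀ j k → T (suc j) (suc k) ≈ doubleLaplaceTerm (x ∘ suc) (λ j k → D (suc j) (suc k)) j k
    shift j k = *-congʳ (trans (*-cong (sgn-suc (toℕ j)) (sgn-suc (toℕ k)))
                               (solve 2 (λ a b → :- a :* :- b := a :* b) refl (sgnᶠ j) (sgnᶠ k)))

  det-firstTwoRowsEqual : ∀ {m} (A : Matrix (suc (suc m))) →
                          (∀ j → A zero j ≈ A (suc zero) j) → det A ≈ 0#
  det-firstTwoRowsEqual {m} A row0≈row1 = begin
    det A                                                   ≈⟨ Σᶠ-cong {f = laplaceTerm A} expand ⟩
    Σᶠ (λ j → Σᶠ (λ k → doubleLaplaceTerm (A zero) D j k))  ≈⟨ doubleLaplace-vanishes (suc m) (A zero) D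
                                                                  (selection-pairSymmetric m Φ Φ-cong) ⟩
    0#                                                      ∎
    where
    D : Fin (suc (suc m)) → Fin (suc m) → Carrier
    D j k = det (minor (minor A j) k)
    Φ : (Fin m → Fin (suc (suc m))) → Carrier
    Φ s = det (λ a c → A (suc (suc a)) (s c))
    Φ-cong : ∀ s t → (∀ c → s c ≡ t c) → Φ s ≈ Φ t
    Φ-cong s t s≗t = det-cong (λ a c → reflexive (≡.cong (A (suc (suc a))) (s≗t c)))
    expand : ∀ j → laplaceTerm A j ≈ Σᶠ (λ k → doubleLaplaceTerm (A zero) D j k)
    expand j = begin
      sgnᶠ j * (A zero j * Σᶠ second)                   ≈⟨ *-congˡ (*-distribˡ-Σᶠ (A zero j) second) ⟩
      sgnᶠ j * Σᶠ (λ k → A zero j * second k)           ≈⟨ *-distribˡ-Σᶠ (sgnᶠ j) (λ k → A zero j * second k) ⟩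
      Σᶠ (λ k → sgnᶠ j * (A zero j * second k))         ≈⟨ Σᶠ-cong {f = λ k → sgnᶠ j * (A zero j * second k)} term ⟩
      Σᶠ (λ k → doubleLaplaceTerm (A zero) D j k)       ∎
      where
      second : Fin (suc m) → Carrier
      second k = sgnᶠ k * (A (suc zero) (punchIn j k) * D j k)
      term : ∀ k → sgnᶠ j * (A zero j * second k) ≈ doubleLaplaceTerm (A zero) D j k
      term k = trans (*-congˡ (*-congˡ (*-congˡ (*-congʳ (sym (row0≈row1 (punchIn j k)))))))
        (solve 5 (λ s a t b d → s :* (a :* (t :* (b :* d))) := (s :* t) :* ((a :* b) :* d))
               refl (sgnᶠ j) (A zero j) (sgnᶠ k) (A zero (punchIn j k)) (D j k))

  -- For b > 0, swapping rows 1 and b + 1 negates every first-row minor and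
  -- reduces to the case b = 0.
  det-firstRowRepeated : ∀ {m} → IsAlternatingMultilinear (det {suc m}) →
                         ∀ (b : Fin (suc m)) (A : Matrix (suc (suc m))) →
                         (∀ j → A zero j ≈ A (suc b) j) → det A ≈ 0#
  det-firstRowRepeated _ zero A row0≈row1 = det-firstTwoRowsEqual A row0≈row1
  det-firstRowRepeated {suc m} det-form (suc b) A row0≈row = begin
    det A      ≈⟨ -‿involutive (det A) ⟨
    - - det A  ≈⟨ -‿cong det-N≈-det-A ⟨
    - det N    ≈⟨ -‿cong (det-firstTwoRowsEqual N (λ j → trans (N-other zero (λ ()) (λ ()) j)
                                                    (trans (row0≈row j) (sym (N-row₁ j))))) ⟩
    - 0#       ≈⟨ -0#≈0# ⟩
    0#         ∎
    where
    b′ : Fin (suc (suc (suc m)))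
    b′ = suc (suc b)
    N₁ N : Matrix (suc (suc (suc m)))
    N₁ = setRow A (suc zero) (A b′)
    N  = setRow N₁ b′ (A (suc zero))
    N-row₁ : ∀ j → N (suc zero) j ≈ A b′ j
    N-row₁ j = trans (setRow-minimal N₁ {b′} (A (suc zero)) {suc zero} j (λ ())) (setRow-updates A (suc zero) (A b′) j)
    N-row-b′ : ∀ j → N b′ j ≈ A (suc zero) j
    N-row-b′ = setRow-updates N₁ b′ (A (suc zero))
    N-other : ∀ i → i ≢ suc zero → i ≢ b′ → ∀ j → N i j ≈ A i j
    N-other i i≢1 i≢b′ j = trans (setRow-minimal N₁ (A (suc zero)) j i≢b′) (setRow-minimal A (A b′) j i≢1)
    minor-N : ∀ j → det (minor N j) ≈ - det (minor A j)
    minor-N j = swapRows-negates det-form {zero} {suc b} (λ ()) (minor A j) (minor N j)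
      (N-row₁ ∘ punchIn j) (N-row-b′ ∘ punchIn j)
      (λ i i≢0 i≢b c → N-other (suc i) (i≢0 ∘ Fin.suc-injective) (i≢b ∘ Fin.suc-injective) (punchIn j c))
    det-N≈-det-A : det N ≈ - det A
    det-N≈-det-A = begin
      Σᶠ (laplaceTerm N)
        ≈⟨ Σᶠ-cong {f = laplaceTerm N} (λ j → *-congˡ (*-cong (N-other zero (λ ()) (λ ()) j) (minor-N j))) ⟩
      Σᶠ (λ j → sgnᶠ j * (A zero j * - det (minor A j)))
        ≈⟨ Σᶠ-cong (λ j → solve 3 (λ s a d → s :* (a :* :- d) := :- (s :* (a :* d)))
                                  refl (sgnᶠ j) (A zero j) (det (minor A j))) ⟩
      Σᶠ (λ j → - laplaceTerm A j)
        ≈⟨ Σᶠ-neg (laplaceTerm A) ⟩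
      - det A ∎

  det-alternating : ∀ {m} {a b} (A : Matrix m) → a ≢ b → (∀ j → A a j ≈ A b j) → det A ≈ 0#

  det-isAlternatingMultilinear : ∀ {m} → IsAlternatingMultilinear (det {m})
  det-isAlternatingMultilinear = record
    { cong = det-cong ; linear = det-linear ; alternating = det-alternating }

  det-alternating {suc m} {zero} {zero} A 0≢0 _ = contradiction ≡.refl 0≢0
  det-alternating {suc m} {suc a} {suc b} A a≢b rowa≈rowb = Σᶠ-zero {f = laplaceTerm A} λ j →
    trans (*-congˡ (*-congˡ (det-alternating (minor A j) (a≢b ∘ ≡.cong suc) (rowa≈rowb ∘ punchIn j))))
          (trans (*-congˡ (zeroʳ _)) (zeroʳ _))
  det-alternating {suc (suc m)} {zero}  {suc b} A _ row0≈row =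
    det-firstRowRepeated det-isAlternatingMultilinear b A row0≈row
  det-alternating {suc (suc m)} {suc a} {zero}  A _ row≈row0 =
    det-firstRowRepeated det-isAlternatingMultilinear a A (sym ∘ row≈row0)

  module _ {m} {f : Matrix m → Carrier} (form : IsAlternatingMultilinear f) where
    open IsAlternatingMultilinear form

    linear-Σᶠ : ∀ a (A : Matrix m) {k} (w : Fin k → Carrier) (V : Fin k → Fin m → Carrier) →
                f (setRow A a (λ c → Σᶠ (λ t → w t * V t c))) ≈ Σᶠ (λ t → w t * f (setRow A a (V t)))
    linear-Σᶠ a A {zero} w V = begin
      f Z              ≈⟨ linear a 0# 0# Z Z Z (λ _ _ _ → refl) (λ _ _ _ → refl)
                                 (λ j → trans (setRow-updates A a _ j) (sym (trans (+-cong (zeroˡ _) (zeroˡ _)) (+-identityʳ 0#)))) ⟩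
      0# * f Z + 0# * f Z  ≈⟨ +-cong (zeroˡ _) (zeroˡ _) ⟩
      0# + 0#          ≈⟨ +-identityʳ 0# ⟩
      0#               ∎
      where
      Z : Matrix m
      Z = setRow A a (λ _ → 0#)
    linear-Σᶠ a A {suc k} w V = begin
      f (setRow A a (λ c → w zero * V zero c + Σᶠ (λ t → w (suc t) * V (suc t) c)))
        ≈⟨ linear a (w zero) 1# _ _ _ (setRow-agreeOffRow A a _ _) (setRow-agreeOffRow A a _ _)
             (λ j → trans (setRow-updates A a _ j)
                    (+-cong (*-congˡ (sym (setRow-updates A a _ j)))
                            (trans (sym (*-identityˡ _)) (*-congˡ (sym (setRow-updates A a _ j)))))) ⟩
      w zero * f (setRow A a (V zero)) + 1# * f (setRow A a (λ c → Σᶠ (λ t → w (suc t) * V (suc t) c)))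
        ≈⟨ +-congˡ (trans (*-identityˡ _) (linear-Σᶠ a A (w ∘ suc) (V ∘ suc))) ⟩
      w zero * f (setRow A a (V zero)) + Σᶠ (λ t → w (suc t) * f (setRow A a (V (suc t)))) ∎

    addMultipleOfRow : ∀ {a b} → a ≢ b → ∀ (A B : Matrix m) t → AgreeOffRow a A B →
                       (∀ j → A a j ≈ B a j + t * B b j) → f A ≈ f B
    addMultipleOfRow {a} {b} a≢b A B t A~B rowa = begin
      f A               ≈⟨ linear a 1# t A B B′ A~B
                             (λ i i≢a j → trans (A~B i i≢a j) (sym (setRow-minimal B (B b) j i≢a)))
                             (λ j → trans (rowa j) (+-cong (sym (*-identityˡ _))
                                                           (*-congˡ (sym (setRow-updates B a (B b) j))))) ⟩
      1# * f B + t * f B′  ≈⟨ +-cong (*-identityˡ _) (*-congˡ (alternating B′ a≢b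
                               (λ j → trans (setRow-updates B a (B b) j)
                                            (sym (setRow-minimal B (B b) j (a≢b ∘ ≡.sym)))))) ⟩
      f B + t * 0#      ≈⟨ +-congˡ (zeroʳ t) ⟩
      f B + 0#          ≈⟨ +-identityʳ _ ⟩
      f B               ∎
      where
      B′ : Matrix m
      B′ = setRow B a (B b)

  moveToFront : ∀ {m} → Fin (suc m) → Matrix (suc m)
  moveToFront j zero    = δ j
  moveToFront j (suc a) = δ (punchIn j a)

  punchIn-inject₁-self : ∀ {m} (i : Fin m) → punchIn (inject₁ i) i ≡ suc i
  punchIn-inject₁-self zero    = ≡.refl
  punchIn-inject₁-self (suc i) = ≡.cong suc (punchIn-inject₁-self i)

  punchIn-suc-self : ∀ {m} (i : Fin m) → punchIn (suc i) i ≡ inject₁ i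
  punchIn-suc-self zero    = ≡.refl
  punchIn-suc-self (suc i) = ≡.cong suc (punchIn-suc-self i)

  punchIn-suc≡punchIn-inject₁ : ∀ {m} {i a : Fin m} → a ≢ i → punchIn (suc i) a ≡ punchIn (inject₁ i) a
  punchIn-suc≡punchIn-inject₁ {i = zero}  {zero}  a≢i = contradiction ≡.refl a≢i
  punchIn-suc≡punchIn-inject₁ {i = zero}  {suc a} a≢i = ≡.refl
  punchIn-suc≡punchIn-inject₁ {i = suc i} {zero}  a≢i = ≡.refl
  punchIn-suc≡punchIn-inject₁ {i = suc i} {suc a} a≢i =
    ≡.cong suc (punchIn-suc≡punchIn-inject₁ (a≢i ∘ ≡.cong suc))

  <?-suc : ∀ {k p} → k ≢ p → does (k ℕ.<? suc p) ≡ does (k ℕ.<? p)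
  <?-suc {k} {p} k≢p with k ℕ.<? p
  ... | yes k<p = ≡.trans (dec-true (k ℕ.<? suc p) (ℕ.m<n⇒m<1+n k<p)) (≡.sym (dec-true (k ℕ.<? p) k<p))
  ... | no  k≮p = ≡.trans (dec-false (k ℕ.<? suc p) ([ k≮p , k≢p ]′ ∘ ℕ.m<1+n⇒m<n∨m≡n))
                          (≡.sym (dec-false (k ℕ.<? p) k≮p))

  module _ {m} {f : Matrix (suc m) → Carrier} (form : IsAlternatingMultilinear f) where
    open IsAlternatingMultilinear form

    -- Swapping rows 0 and i + 1 of moveToFront (inject₁ i) gives moveToFront (suc i).
    moveToFront-sign : ∀ j → f (moveToFront j) ≈ sgnᶠ j * f I
    moveToFront-sign = <-weakInduction (λ j → f (moveToFront j) ≈ sgnᶠ j * f I) base next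
      where
      base : f (moveToFront zero) ≈ 1# * f I
      base = trans (cong λ { zero _ → refl ; (suc _) _ → refl }) (sym (*-identityˡ _))
      next : ∀ i → f (moveToFront (inject₁ i)) ≈ sgnᶠ (inject₁ i) * f I →
             f (moveToFront (suc i)) ≈ sgnᶠ (suc i) * f I
      next i IH = begin
        f (moveToFront (suc i))
          ≈⟨ swapRows-negates form {zero} {suc i} (λ ()) (moveToFront (inject₁ i)) (moveToFront (suc i))
               (λ c → reflexive (≡.cong (λ k → δ k c) (≡.sym (punchIn-inject₁-self i))))
               (λ c → reflexive (≡.cong (λ k → δ k c) (punchIn-suc-self i)))
               (λ { zero 0≢0 _ → contradiction ≡.refl 0≢0
                  ; (suc a) _ a≢i c → reflexive (≡.cong (λ k → δ k c)
                                         (punchIn-suc≡punchIn-inject₁ (a≢i ∘ ≡.cong suc))) }) ⟩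
        - f (moveToFront (inject₁ i))        ≈⟨ -‿cong IH ⟩
        - (sgnᶠ (inject₁ i) * f I)           ≡⟨ ≡.cong (λ k → - (sgn k * f I)) (Fin.toℕ-inject₁ i) ⟩
        - (sgnᶠ i * f I)                     ≈⟨ -‿distribˡ-* _ _ ⟩
        - sgnᶠ i * f I                       ≈⟨ *-congʳ (sgn-suc (toℕ i)) ⟨
        sgnᶠ (suc i) * f I                   ∎

    -- mix p takes its first p rows from B and the others from A; consecutive
    -- mixes differ by adding a multiple of the first row δ j to one row.
    clearColumn : ∀ j (A B : Matrix (suc m)) (t : Fin (suc m) → Carrier) →
                  (∀ c → A zero c ≈ δ j c) → (∀ c → B zero c ≈ δ j c) →
                  (∀ i c → A i c ≈ B i c + t i * δ j c) → f A ≈ f B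
    clearColumn j A B t A₀ B₀ A≈B+tδ = trans (sym (cleared (suc m))) (cong all-cleared)
      where
      mix : ℕ → Matrix (suc m)
      mix p i = if does (toℕ i ℕ.<? p) then B i else A i

      mix-early : ∀ p i → toℕ i ℕ.< p → mix p i ≡ B i
      mix-early p i i<p = ≡.cong (λ b → if b then B i else A i) (dec-true (_ ℕ.<? _) i<p)

      mix-late : ∀ p i → ¬ toℕ i ℕ.< p → mix p i ≡ A i
      mix-late p i i≮p = ≡.cong (λ b → if b then B i else A i) (dec-false (_ ℕ.<? _) i≮p)

      mix-off : ∀ p i → toℕ i ≢ p → mix (suc p) i ≡ mix p i
      mix-off p i i≢p = ≡.cong (λ b → if b then B i else A i) (<?-suc i≢p)

      row≈ : ∀ {u v : Fin (suc m) → Carrier} → u ≡ v → ∀ c → u c ≈ v c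
      row≈ u≡v c = reflexive (≡.cong (_$ c) u≡v)

      mix-step : ∀ p → f (mix (suc p)) ≈ f (mix p)
      mix-step zero = cong λ
        { zero c → trans (row≈ (mix-early 1 zero ℕ.z<s) c)
                         (trans (B₀ c) (trans (sym (A₀ c)) (row≈ (≡.sym (mix-late 0 zero λ ())) c)))
        ; (suc a) c → row≈ (mix-off 0 (suc a) λ ()) c }
      mix-step (suc p) with suc p ℕ.<? suc m
      ... | no p≮ = cong λ i → row≈ (mix-off (suc p) i λ i≡p → p≮ (≡.subst (ℕ._< suc m) i≡p (Fin.toℕ<n i)))
      ... | yes p< = sym (addMultipleOfRow form i₀≢0 (mix (suc p)) (mix (suc (suc p))) (t i₀) agree row)
        where
        i₀ : Fin (suc m)
        i₀ = Fin.fromℕ< p<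
        toℕ-i₀ : toℕ i₀ ≡ suc p
        toℕ-i₀ = Fin.toℕ-fromℕ< p<
        i₀≢0 : i₀ ≢ zero
        i₀≢0 i₀≡0 = ℕ.1+n≢0 (≡.trans (≡.sym toℕ-i₀) (≡.cong toℕ i₀≡0))
        agree : AgreeOffRow i₀ (mix (suc p)) (mix (suc (suc p)))
        agree i i≢i₀ = row≈ (≡.sym (mix-off (suc p) i λ i≡p →
                         i≢i₀ (Fin.toℕ-injective (≡.trans i≡p (≡.sym toℕ-i₀)))))
        row : ∀ c → mix (suc p) i₀ c ≈ mix (suc (suc p)) i₀ c + t i₀ * mix (suc (suc p)) zero c
        row c = begin
          mix (suc p) i₀ c                ≈⟨ row≈ (mix-late (suc p) i₀ (ℕ.<-irrefl toℕ-i₀)) c ⟩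
          A i₀ c                          ≈⟨ A≈B+tδ i₀ c ⟩
          B i₀ c + t i₀ * δ j c           ≈⟨ +-cong (row≈ (≡.sym (mix-early (suc (suc p)) i₀
                                                                 (≡.subst (ℕ._< suc (suc p)) (≡.sym toℕ-i₀) (ℕ.n<1+n _)))) c)
                                                    (*-congˡ (trans (sym (B₀ c)) (row≈ (≡.sym (mix-early (suc (suc p)) zero ℕ.z<s)) c))) ⟩
          mix (suc (suc p)) i₀ c + t i₀ * mix (suc (suc p)) zero c ∎

      all-cleared : mix (suc m) ≈ᴹ B
      all-cleared i = row≈ (mix-early (suc m) i (Fin.toℕ<n i))

      cleared : ∀ p → f (mix p) ≈ f A
      cleared zero    = cong λ i → row≈ (mix-late 0 i λ ())
      cleared (suc p) = trans (mix-step p) (cleared p)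

  punchIn-elim : ∀ {m} (P : Fin (suc m) → Set ℓ) j → P j → (∀ k → P (punchIn j k)) → ∀ k → P k
  punchIn-elim P j Pj P-punchIn k with k ≟ j
  ... | yes ≡.refl = Pj
  ... | no  k≢j    = ≡.subst P (Fin.punchIn-punchOut (k≢j ∘ ≡.sym)) (P-punchIn _)

  insertAt-cong : ∀ {m} (j : Fin (suc m)) {u v : Fin m → Carrier} → (∀ i → u i ≈ v i) →
                  ∀ k → insertAt u j 0# k ≈ insertAt v j 0# k
  insertAt-cong j {u} {v} u≈v = punchIn-elim _ j
    (reflexive (≡.trans (insertAt-lookup u j 0#) (≡.sym (insertAt-lookup v j 0#))))
    (λ k → trans (reflexive (insertAt-punchIn u j 0# k))
                 (trans (u≈v k) (reflexive (≡.sym (insertAt-punchIn v j 0# k)))))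

  insertAt-linear : ∀ {m} (j : Fin (suc m)) x y {u v w : Fin m → Carrier} →
                    (∀ i → u i ≈ x * v i + y * w i) →
                    ∀ k → insertAt u j 0# k ≈ x * insertAt v j 0# k + y * insertAt w j 0# k
  insertAt-linear j x y {u} {v} {w} u≈ = punchIn-elim _ j
    (begin
      insertAt u j 0# j                                 ≡⟨ insertAt-lookup u j 0# ⟩
      0#                                                ≈⟨ solve 2 (λ x y → 0ᴾ := x :* 0ᴾ :+ y :* 0ᴾ) refl x y ⟩
      x * 0# + y * 0#                                   ≡⟨ ≡.cong₂ (λ p q → x * p + y * q)
                                                             (insertAt-lookup v j 0#) (insertAt-lookup w j 0#) ⟨
      x * insertAt v j 0# j + y * insertAt w j 0# j     ∎)
    (λ k → begin
      insertAt u j 0# (punchIn j k)                     ≡⟨ insertAt-punchIn u j 0# k ⟩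
      u k                                               ≈⟨ u≈ k ⟩
      x * v k + y * w k                                 ≡⟨ ≡.cong₂ (λ p q → x * p + y * q)
                                                             (insertAt-punchIn v j 0# k) (insertAt-punchIn w j 0# k) ⟨
      x * insertAt v j 0# (punchIn j k) + y * insertAt w j 0# (punchIn j k) ∎)

  insertAt-δ : ∀ {m} (j : Fin (suc m)) (a : Fin m) → ∀ k → insertAt (δ a) j 0# k ≈ δ (punchIn j a) k
  insertAt-δ j a = punchIn-elim _ j
    (reflexive (≡.trans (insertAt-lookup (δ a) j 0#) (≡.sym (δ-≢ (Fin.punchInᵢ≢i j a)))))
    (λ k → reflexive (≡.trans (insertAt-punchIn (δ a) j 0# k)
                              (≡.sym (δ-injective (punchIn j) (Fin.punchIn-injective j _ _) a k))))

  insertAt-removeAt : ∀ {m} (v : Fin (suc m) → Carrier) j →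
                      ∀ k → v k ≈ insertAt (removeAt v j) j 0# k + v j * δ j k
  insertAt-removeAt v j = punchIn-elim _ j
    (begin
      v j                                               ≈⟨ solve 1 (λ x → x := 0ᴾ :+ x :* 1ᴾ) refl (v j) ⟩
      0# + v j * 1#                                     ≡⟨ ≡.cong₂ (λ p q → p + v j * q)
                                                             (insertAt-lookup (removeAt v j) j 0#) (δ-≡ ≡.refl) ⟨
      insertAt (removeAt v j) j 0# j + v j * δ j j      ∎)
    (λ k → begin
      v (punchIn j k)                                   ≈⟨ solve 2 (λ x y → x := x :+ y :* 0ᴾ) refl _ (v j) ⟩
      v (punchIn j k) + v j * 0#                        ≡⟨ ≡.cong₂ (λ p q → p + v j * q)
                                                             (insertAt-punchIn (removeAt v j) j 0# k)
                                                             (δ-≢ (Fin.punchInᵢ≢i j k ∘ ≡.sym)) ⟨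
      insertAt (removeAt v j) j 0# (punchIn j k) + v j * δ j (punchIn j k) ∎)

  border : ∀ {m} → Fin (suc m) → Matrix m → Matrix (suc m)
  border j N zero    = δ j
  border j N (suc a) = insertAt (N a) j 0#

  border-identity : ∀ {m} (j : Fin (suc m)) → border j I ≈ᴹ moveToFront j
  border-identity j zero    c = refl
  border-identity j (suc a) c = insertAt-δ j a c

  border-isAlternatingMultilinear : ∀ {m} {f : Matrix (suc m) → Carrier} →
    IsAlternatingMultilinear f → ∀ j → IsAlternatingMultilinear (f ∘ border j)
  border-isAlternatingMultilinear form j = record
    { cong        = λ N≈N′ → cong λ { zero c → refl ; (suc a) → insertAt-cong j (N≈N′ a) }
    ; linear      = λ a x y A B C A~B A~C row → linear (suc a) x y (border j A) (border j B) (border j C)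
                      (border-agree A~B) (border-agree A~C) (insertAt-linear j x y row)
    ; alternating = λ A a≢b rows → alternating (border j A) (a≢b ∘ Fin.suc-injective) (insertAt-cong j rows)
    }
    where
    open IsAlternatingMultilinear form
    border-agree : ∀ {a} {A B} → AgreeOffRow a A B → AgreeOffRow (suc a) (border j A) (border j B)
    border-agree A~B zero    _    c = refl
    border-agree A~B (suc i) i≢a  = insertAt-cong j (A~B i (i≢a ∘ ≡.cong suc))

  -- Expand the first row; the term for column t is, after clearing column t
  -- below it, the alternating multilinear form f ∘ border t one size down,
  -- evaluated at minor A t, and f (border t I) = f (moveToFront t) = ±f I.
  alternatingMultilinear≈det : ∀ {m} {f : Matrix m → Carrier} → IsAlternatingMultilinear f →
                               ∀ A → f A ≈ det A * f I
  alternatingMultilinear≈det {zero} form A = trans (cong λ ()) (sym (*-identityˡ _))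
    where open IsAlternatingMultilinear form
  alternatingMultilinear≈det {suc m} {f} form A = begin
    f A                                             ≈⟨ cong first-row-expanded ⟨
    f (setRow A zero (λ c → Σᶠ (λ t → A zero t * δ t c)))
                                                    ≈⟨ linear-Σᶠ form zero A (A zero) δ ⟩
    Σᶠ (λ t → A zero t * f (setRow A zero (δ t)))   ≈⟨ Σᶠ-cong {f = λ t → A zero t * f (setRow A zero (δ t))}
                                                                (λ t → *-congˡ (trans (cleared t) (bordered t))) ⟩
    Σᶠ (λ t → A zero t * (det (minor A t) * (sgnᶠ t * f I)))
                                                    ≈⟨ Σᶠ-cong (λ t → solve 4 (λ a d s x → a :* (d :* (s :* x)) := (s :* (a :* d)) :* x)
                                                                             refl (A zero t) (det (minor A t)) (sgnᶠ t) (f I)) ⟩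
    Σᶠ (λ t → laplaceTerm A t * f I)                ≈⟨ *-distribʳ-Σᶠ (f I) (laplaceTerm A) ⟨
    det A * f I                                     ∎
    where
    open IsAlternatingMultilinear form
    first-row-expanded : setRow A zero (λ c → Σᶠ (λ t → A zero t * δ t c)) ≈ᴹ A
    first-row-expanded zero    c = trans (setRow-updates A zero (λ c → Σᶠ (λ t → A zero t * δ t c)) c) (Σᶠ-δʳ c (A zero))
    first-row-expanded (suc i) c = setRow-minimal A {zero} (λ c → Σᶠ (λ t → A zero t * δ t c)) c λ ()

    cleared : ∀ t → f (setRow A zero (δ t)) ≈ f (border t (minor A t))
    cleared t = clearColumn form t (setRow A zero (δ t)) (border t (minor A t)) coefficient
      (setRow-updates A zero (δ t)) (λ _ → refl) rows
      where
      coefficient : Fin (suc m) → Carrier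
      coefficient zero    = 0#
      coefficient (suc a) = A (suc a) t
      rows : ∀ i c → setRow A zero (δ t) i c ≈ border t (minor A t) i c + coefficient i * δ t c
      rows zero    c = trans (setRow-updates A zero (δ t) c) (solve 1 (λ x → x := x :+ 0ᴾ :* x) refl (δ t c))
      rows (suc a) c = trans (setRow-minimal A {zero} (δ t) c λ ()) (insertAt-removeAt (A (suc a)) t c)

    bordered : ∀ t → f (border t (minor A t)) ≈ det (minor A t) * (sgnᶠ t * f I)
    bordered t = trans (alternatingMultilinear≈det (border-isAlternatingMultilinear form t) (minor A t))
                       (*-congˡ (trans (cong (border-identity t)) (moveToFront-sign form t)))

  det-· : ∀ {m} (A B : Matrix m) → det (A · B) ≈ det A * det B
  det-· {m} A B = trans (alternatingMultilinear≈det form A) (*-congˡ (det-cong (·-identityˡ B)))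
    where
    rows· : ∀ {u v : Fin m → Carrier} → (∀ k → u k ≈ v k) → ∀ j → Σᶠ (λ k → u k * B k j) ≈ Σᶠ (λ k → v k * B k j)
    rows· u≈v j = Σᶠ-cong (λ k → *-congʳ (u≈v k))
    form : IsAlternatingMultilinear (λ X → det (X · B))
    form = record
      { cong        = λ X≈X′ → det-cong (λ i → rows· (X≈X′ i))
      ; linear      = λ a x y X X′ X″ X~X′ X~X″ row → det-linear a x y (X · B) (X′ · B) (X″ · B)
                        (λ i i≢a → rows· (X~X′ i i≢a)) (λ i i≢a → rows· (X~X″ i i≢a))
                        (λ j → Σᶠ-linear x y λ k → trans (*-congʳ (row k))
                          (solve 5 (λ x y u v b → (x :* u :+ y :* v) :* b := x :* (u :* b) :+ y :* (v :* b))
                                 refl x y (X′ a k) (X″ a k) (B k j)))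
      ; alternating = λ X a≢b rows → det-alternating (X · B) a≢b (rows· rows)
      }

  det-permute : ∀ {k m} (π : Permutation k m) (A : Matrix m) →
                det (λ c d → A (π ⟨$⟩ʳ c) (π ⟨$⟩ʳ d)) ≈ det A
  det-permute {k} {m} π A = begin
    f A              ≈⟨ alternatingMultilinear≈det form A ⟩
    det A * f I      ≈⟨ *-congˡ (trans (det-cong {A = λ c d → δ (σ c) (σ d)} {B = I}
                                         (λ c d → reflexive (δ-injective σ σ-injective c d)))
                                       (det-identity {k})) ⟩
    det A * 1#       ≈⟨ *-identityʳ _ ⟩
    det A            ∎
    where
    σ : Fin k → Fin m
    σ = π ⟨$⟩ʳ_
    σ-injective : Injective _≡_ _≡_ σ
    σ-injective {c} {d} σc≡σd = ≡.trans (≡.sym (Perm.inverseˡ π)) (≡.trans (≡.cong (π ⟨$⟩ˡ_) σc≡σd) (Perm.inverseˡ π))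
    σ≢ : ∀ {c a} → c ≢ π ⟨$⟩ˡ a → σ c ≢ a
    σ≢ c≢ σc≡a = c≢ (≡.trans (≡.sym (Perm.inverseˡ π)) (≡.cong (π ⟨$⟩ˡ_) σc≡a))
    atRow : ∀ (X : Matrix m) a d → X (σ (π ⟨$⟩ˡ a)) (σ d) ≡ X a (σ d)
    atRow X a d = ≡.cong (λ i → X i (σ d)) (Perm.inverseʳ π)
    f : Matrix m → Carrier
    f X = det (λ c d → X (σ c) (σ d))
    form : IsAlternatingMultilinear f
    form = record
      { cong        = λ X≈X′ → det-cong (λ c d → X≈X′ (σ c) (σ d))
      ; linear      = λ a x y X X′ X″ X~X′ X~X″ row → det-linear (π ⟨$⟩ˡ a) x y _ _ _
                        (λ c c≢ d → X~X′ (σ c) (σ≢ c≢) (σ d)) (λ c c≢ d → X~X″ (σ c) (σ≢ c≢) (σ d))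
                        (λ d → ≡.subst (λ i → X i (σ d) ≈ x * X′ i (σ d) + y * X″ i (σ d))
                                       (≡.sym (Perm.inverseʳ π)) (row (σ d)))
      ; alternating = λ {a} {b} X a≢b rows → det-alternating {a = π ⟨$⟩ˡ a} {b = π ⟨$⟩ˡ b} _
                        (a≢b ∘ λ eq → ≡.trans (≡.sym (Perm.inverseʳ π)) (≡.trans (≡.cong σ eq) (Perm.inverseʳ π)))
                        (λ d → trans (reflexive (atRow X a d)) (trans (rows (σ d)) (reflexive (≡.sym (atRow X b d)))))
      }

  -- Direct sums and Kronecker products

  ⊕-entry : ∀ {p q} → Matrix p → Matrix q → Fin p ⊎ Fin q → Fin p ⊎ Fin q → Carrier
  ⊕-entry B C (inj₁ a) (inj₁ b) = B a b
  ⊕-entry B C (inj₁ a) (inj₂ b) = 0#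
  ⊕-entry B C (inj₂ a) (inj₁ b) = 0#
  ⊕-entry B C (inj₂ a) (inj₂ b) = C a b

  infixr 6 _⊕_
  _⊕_ : ∀ {p q} → Matrix p → Matrix q → Matrix (p ℕ.+ q)
  (_⊕_ {p} B C) i j = ⊕-entry B C (Fin.splitAt p i) (Fin.splitAt p j)

  det-I⊕ : ∀ p {q} (C : Matrix q) → det (I {p} ⊕ C) ≈ det C
  det-I⊕ zero    C = det-cong {A = I {0} ⊕ C} {B = C} (λ _ _ → refl)
  det-I⊕ (suc p) C = begin
    det (I {suc p} ⊕ C)                    ≈⟨ Σᶠ-head (laplaceTerm (I {suc p} ⊕ C))
                                                (λ j → trans (*-congˡ (trans (*-congʳ (first-row j)) (zeroˡ _))) (zeroʳ _)) ⟩
    1# * (1# * det (minor (I {suc p} ⊕ C) zero))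
                                           ≈⟨ trans (*-identityˡ _) (*-identityˡ _) ⟩
    det (minor (I {suc p} ⊕ C) zero)       ≈⟨ det-cong {A = minor (I {suc p} ⊕ C) zero} {B = I {p} ⊕ C} minor≈ ⟩
    det (I {p} ⊕ C)                        ≈⟨ det-I⊕ p C ⟩
    det C                                  ∎
    where
    first-row : ∀ j → (I {suc p} ⊕ C) zero (suc j) ≈ 0#
    first-row j with Fin.splitAt p j
    ... | inj₁ _ = refl
    ... | inj₂ _ = refl
    minor≈ : minor (I {suc p} ⊕ C) zero ≈ᴹ (I {p} ⊕ C)
    minor≈ a b with Fin.splitAt p a | Fin.splitAt p b
    ... | inj₁ x | inj₁ y = δ-suc x y
    ... | inj₁ _ | inj₂ _ = refl
    ... | inj₂ _ | inj₁ _ = refl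
    ... | inj₂ _ | inj₂ _ = refl

  det-⊕ : ∀ {p q} (B : Matrix p) (C : Matrix q) → det (B ⊕ C) ≈ det B * det C
  det-⊕ {p} {q} B C = trans (alternatingMultilinear≈det form B) (*-congˡ (det-I⊕ p C))
    where
    f : Matrix p → Carrier
    f X = det (X ⊕ C)
    upper-row : ∀ (X X′ : Matrix p) a a′ → (∀ b → X a b ≈ X′ a′ b) →
                ∀ t → ⊕-entry X C (inj₁ a) t ≈ ⊕-entry X′ C (inj₁ a′) t
    upper-row X X′ a a′ rows (inj₁ b) = rows b
    upper-row X X′ a a′ rows (inj₂ b) = refl

    lower-row : ∀ (X X′ : Matrix p) y t → ⊕-entry X C (inj₂ y) t ≈ ⊕-entry X′ C (inj₂ y) t
    lower-row X X′ y (inj₁ _) = refl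
    lower-row X X′ y (inj₂ _) = refl

    ⊕-rows : ∀ (X X′ : Matrix p) i → (∀ {i′} → Fin.splitAt p i ≡ inj₁ i′ → ∀ b → X i′ b ≈ X′ i′ b) →
             ∀ d → (X ⊕ C) i d ≈ (X′ ⊕ C) i d
    ⊕-rows X X′ i rows d with Fin.splitAt p i
    ... | inj₁ i′ = upper-row X X′ i′ i′ (rows ≡.refl) (Fin.splitAt p d)
    ... | inj₂ y  = lower-row X X′ y (Fin.splitAt p d)

    agree : ∀ {a} (X X′ : Matrix p) → AgreeOffRow a X X′ → AgreeOffRow (a ↑ˡ q) (X ⊕ C) (X′ ⊕ C)
    agree X X′ X~X′ i i≢a = ⊕-rows X X′ i λ eq →
      X~X′ _ (i≢a ∘ ≡.trans (≡.sym (Fin.splitAt⁻¹-↑ˡ eq)) ∘ ≡.cong (_↑ˡ q))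

    row-a : ∀ (X : Matrix p) a d → (X ⊕ C) (a ↑ˡ q) d ≡ ⊕-entry X C (inj₁ a) (Fin.splitAt p d)
    row-a X a d = ≡.cong (λ s → ⊕-entry X C s (Fin.splitAt p d)) (Fin.splitAt-↑ˡ p a q)

    form : IsAlternatingMultilinear f
    form = record
      { cong        = λ {X} {X′} X≈X′ → det-cong λ i → ⊕-rows X X′ i (λ _ → X≈X′ _)
      ; linear      = λ a x y X X′ X″ X~X′ X~X″ row → det-linear (a ↑ˡ q) x y (X ⊕ C) (X′ ⊕ C) (X″ ⊕ C)
                        (agree X X′ X~X′) (agree X X″ X~X″)
                        (λ d → ≡.subst₂ (λ e e′ → e ≈ x * e′ + y * (X″ ⊕ C) (a ↑ˡ q) d)
                                        (≡.sym (row-a X a d)) (≡.sym (row-a X′ a d))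
                                        (≡.subst (λ e → _ ≈ _ + y * e) (≡.sym (row-a X″ a d))
                                                 (linear-row X X′ X″ a x y row (Fin.splitAt p d))))
      ; alternating = λ X a≢b rows → det-alternating (X ⊕ C) (a≢b ∘ Fin.↑ˡ-injective q _ _)
                        (λ d → trans (reflexive (row-a X _ d))
                                     (trans (upper-row X X _ _ rows (Fin.splitAt p d)) (reflexive (≡.sym (row-a X _ d)))))
      }
      where
      linear-row : ∀ (X X′ X″ : Matrix p) a x y → (∀ b → X a b ≈ x * X′ a b + y * X″ a b) →
                   ∀ t → ⊕-entry X C (inj₁ a) t ≈ x * ⊕-entry X′ C (inj₁ a) t + y * ⊕-entry X″ C (inj₁ a) t
      linear-row X X′ X″ a x y row (inj₁ b) = row b
      linear-row X X′ X″ a x y row (inj₂ b) = solve 2 (λ x y → 0ᴾ := x :* 0ᴾ :+ y :* 0ᴾ) refl x y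

  det-blockDiagonal : ∀ ν {n} (B : Fin ν → Matrix n) (Z : Matrix (ν ℕ.* n)) →
    (∀ v v′ u u′ → Z (combine v u) (combine v′ u′) ≈ δ v v′ * B v u u′) → det Z ≈ Πᶠ (λ v → det (B v))
  det-blockDiagonal zero    B Z _      = refl
  det-blockDiagonal (suc ν) {n} B Z blocks = begin
    det Z                                  ≈⟨ det-cong Z≈ ⟩
    det (B zero ⊕ Z′)                      ≈⟨ det-⊕ (B zero) Z′ ⟩
    det (B zero) * det Z′                  ≈⟨ *-congˡ (det-blockDiagonal ν (B ∘ suc) Z′ λ v v′ u u′ →
                                                trans (blocks (suc v) (suc v′) u u′) (*-congʳ (δ-suc v v′))) ⟩
    det (B zero) * Πᶠ (λ v → det (B (suc v))) ∎
    where
    Z′ : Matrix (ν ℕ.* n)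
    Z′ c d = Z (n ↑ʳ c) (n ↑ʳ d)
    combine-quotRem : ∀ c → n ↑ʳ c ≡ combine {suc ν} (suc (Fin.quotient n c)) (Fin.remainder {ν} n c)
    combine-quotRem c = ≡.cong (n ↑ʳ_) (≡.sym (Fin.combine-remQuot {ν} n c))
    off-diagonal : ∀ {v v′} u u′ → v ≢ v′ → Z (combine v u) (combine v′ u′) ≈ 0#
    off-diagonal u u′ v≢v′ = trans (blocks _ _ u u′) (trans (*-congʳ (reflexive (δ-≢ v≢v′))) (zeroˡ _))
    Z≈ : Z ≈ᴹ (B zero ⊕ Z′)
    Z≈ a b with Fin.splitAt n a in eqa | Fin.splitAt n b in eqb
    ... | inj₁ u | inj₁ u′ = ≡.subst₂ (λ a b → Z a b ≈ B zero u u′) (Fin.splitAt⁻¹-↑ˡ eqa) (Fin.splitAt⁻¹-↑ˡ eqb)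
                               (trans (blocks zero zero u u′) (*-identityˡ _))
    ... | inj₁ u | inj₂ c  = ≡.subst₂ (λ a b → Z a b ≈ 0#) (Fin.splitAt⁻¹-↑ˡ eqa) (Fin.splitAt⁻¹-↑ʳ eqb)
                               (≡.subst (λ b → Z _ b ≈ 0#) (≡.sym (combine-quotRem c))
                                        (off-diagonal {zero} {suc (Fin.quotient n c)} u (Fin.remainder {ν} n c) λ ()))
    ... | inj₂ c | inj₁ u  = ≡.subst₂ (λ a b → Z a b ≈ 0#) (Fin.splitAt⁻¹-↑ʳ eqa) (Fin.splitAt⁻¹-↑ˡ eqb)
                               (≡.subst (λ a → Z a _ ≈ 0#) (≡.sym (combine-quotRem c))
                                        (off-diagonal {suc (Fin.quotient n c)} {zero} (Fin.remainder {ν} n c) u λ ()))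
    ... | inj₂ c | inj₂ c′ = ≡.subst₂ (λ a b → Z a b ≈ Z′ c c′) (Fin.splitAt⁻¹-↑ʳ eqa) (Fin.splitAt⁻¹-↑ʳ eqb) refl

  det-sandwich : ∀ {m} (S T Y : Matrix m) → det S * det T ≈ 1# → det ((S · Y) · T) ≈ det Y
  det-sandwich S T Y detS*detT≈1 = begin
    det ((S · Y) · T)          ≈⟨ trans (det-· (S · Y) T) (*-congʳ (det-· S Y)) ⟩
    (det S * det Y) * det T    ≈⟨ solve 3 (λ s y t → (s :* y) :* t := y :* (s :* t)) refl (det S) (det Y) (det T) ⟩
    det Y * (det S * det T)    ≈⟨ *-congˡ detS*detT≈1 ⟩
    det Y * 1#                 ≈⟨ *-identityʳ _ ⟩
    det Y                      ∎

  sandwich-linear : ∀ {m} (A B X X₁ X₂ : Matrix m) x y → (∀ i j → X i j ≈ x * X₁ i j + y * X₂ i j) →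
                    ∀ i j → ((A · X) · B) i j ≈ x * ((A · X₁) · B) i j + y * ((A · X₂) · B) i j
  sandwich-linear A B X X₁ X₂ x y X≈ i j = Σᶠ-linear x y λ k → trans
    (*-congʳ (Σᶠ-linear x y λ l → trans (*-congˡ (X≈ l k))
      (solve 5 (λ a x y p q → a :* (x :* p :+ y :* q) := x :* (a :* p) :+ y :* (a :* q)) refl (A i l) x y (X₁ l k) (X₂ l k))))
    (solve 5 (λ b x y p q → (x :* p :+ y :* q) :* b := x :* (p :* b) :+ y :* (q :* b)) refl (B k j) x y _ _)

  infixl 7 _⊗_
  _⊗_ : ∀ {n ν} → Matrix n → Matrix ν → Matrix (n ℕ.* ν)
  (_⊗_ {n} {ν} A B) a b =
    A (Fin.quotient ν a) (Fin.quotient ν b) * B (Fin.remainder {n} ν a) (Fin.remainder {n} ν b)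

  ⊗-combine : ∀ {n ν} (A : Matrix n) (B : Matrix ν) u u′ v v′ →
              (A ⊗ B) (combine u v) (combine u′ v′) ≡ A u u′ * B v v′
  ⊗-combine A B u u′ v v′ = ≡.cong₂ (λ p q → A (proj₁ p) (proj₁ q) * B (proj₂ p) (proj₂ q))
                                     (Fin.remQuot-combine u v) (Fin.remQuot-combine u′ v′)

  ≈ᴹ-combine : ∀ {n ν} {A B : Matrix (n ℕ.* ν)} →
               (∀ u u′ v v′ → A (combine {n} {ν} u v) (combine u′ v′) ≈ B (combine u v) (combine {n} {ν} u′ v′)) →
               A ≈ᴹ B
  ≈ᴹ-combine {n} {ν} {A} {B} A≈B a b = ≡.subst₂ (λ a b → A a b ≈ B a b)
    (Fin.combine-remQuot {n} ν a) (Fin.combine-remQuot {n} ν b)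
    (A≈B (Fin.quotient {n} ν a) (Fin.quotient {n} ν b) (Fin.remainder {n} ν a) (Fin.remainder {n} ν b))

  block : ∀ {n ν} → Matrix (n ℕ.* ν) → Fin n → Fin n → Matrix ν
  block Y u u′ v v′ = Y (combine u v) (combine u′ v′)

  I⊗-· : ∀ {n ν} (A : Matrix ν) (Y : Matrix (n ℕ.* ν)) u u′ v v′ →
         ((I {n} ⊗ A) · Y) (combine u v) (combine u′ v′) ≈ (A · block Y u u′) v v′
  I⊗-· {n} {ν} A Y u u′ v v′ = begin
    Σᶠ (λ c → (I {n} ⊗ A) (combine u v) c * Y c (combine u′ v′))
      ≈⟨ Σᶠ-combine n {ν} (λ c → (I {n} ⊗ A) (combine u v) c * Y c (combine u′ v′)) ⟩
    Σᶠ {n} (λ w → Σᶠ {ν} (λ x → (I {n} ⊗ A) (combine u v) (combine w x) * Y (combine w x) (combine u′ v′)))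
      ≈⟨ Σᶠ-cong {n} (λ w → Σᶠ-cong {ν} (λ x → trans (*-congʳ (reflexive (⊗-combine (I {n}) A u w v x))) (*-assoc _ _ _))) ⟩
    Σᶠ {n} (λ w → Σᶠ {ν} (λ x → δ u w * (A v x * Y (combine w x) (combine u′ v′))))
      ≈⟨ Σᶠ-cong {n} (λ w → *-distribˡ-Σᶠ (δ u w) (λ x → A v x * Y (combine w x) (combine u′ v′))) ⟨
    Σᶠ {n} (λ w → δ u w * Σᶠ {ν} (λ x → A v x * Y (combine w x) (combine u′ v′)))
      ≈⟨ Σᶠ-δˡ u (λ w → Σᶠ (λ x → A v x * Y (combine w x) (combine u′ v′))) ⟩
    Σᶠ (λ x → A v x * Y (combine u x) (combine u′ v′)) ∎

  ·-I⊗ : ∀ {n ν} (Y : Matrix (n ℕ.* ν)) (B : Matrix ν) u u′ v v′ →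
         (Y · (I {n} ⊗ B)) (combine u v) (combine u′ v′) ≈ (block Y u u′ · B) v v′
  ·-I⊗ {n} {ν} Y B u u′ v v′ = begin
    Σᶠ (λ c → Y (combine u v) c * (I {n} ⊗ B) c (combine u′ v′))
      ≈⟨ Σᶠ-combine n {ν} (λ c → Y (combine u v) c * (I {n} ⊗ B) c (combine u′ v′)) ⟩
    Σᶠ {n} (λ w → Σᶠ {ν} (λ x → Y (combine u v) (combine w x) * (I {n} ⊗ B) (combine w x) (combine u′ v′)))
      ≈⟨ Σᶠ-cong {n} (λ w → Σᶠ-cong {ν} {f = λ x → Y (combine u v) (combine w x) * (I {n} ⊗ B) (combine w x) (combine u′ v′)}
           (λ x → trans (*-congˡ (reflexive (⊗-combine (I {n}) B w u′ x v′)))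
                        (solve 3 (λ y d b → y :* (d :* b) := (y :* b) :* d) refl _ (δ w u′) (B x v′)))) ⟩
    Σᶠ {n} (λ w → Σᶠ {ν} (λ x → (Y (combine u v) (combine w x) * B x v′) * δ w u′))
      ≈⟨ Σᶠ-cong {n} (λ w → *-distribʳ-Σᶠ (δ w u′) (λ x → Y (combine u v) (combine w x) * B x v′)) ⟨
    Σᶠ {n} (λ w → Σᶠ {ν} (λ x → Y (combine u v) (combine w x) * B x v′) * δ w u′)
      ≈⟨ Σᶠ-δʳ u′ (λ w → Σᶠ (λ x → Y (combine u v) (combine w x) * B x v′)) ⟩
    Σᶠ (λ x → Y (combine u v) (combine u′ x) * B x v′) ∎

  swapFactors : ∀ {m n} → Permutation (m ℕ.* n) (n ℕ.* m)
  swapFactors {m} {n} = ↔-sym (Fin.*↔× {n} {m}) ↔-∘ (×-comm (Fin m) (Fin n) ↔-∘ Fin.*↔× {m} {n})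

  swapFactors-combine : ∀ {m n} (u : Fin m) (v : Fin n) → swapFactors {m} {n} ⟨$⟩ʳ combine u v ≡ combine v u
  swapFactors-combine {m} {n} u v = ≡.cong (uncurry combine ∘ swap) (Fin.remQuot-combine u v)

  sandwich-linear₃ : ∀ {m} (A B X X₁ X₂ X₃ : Matrix m) x y z →
                     (∀ i j → X i j ≈ x * X₁ i j + y * X₂ i j + z * X₃ i j) →
                     ∀ i j → ((A · X) · B) i j ≈ x * ((A · X₁) · B) i j + y * ((A · X₂) · B) i j + z * ((A · X₃) · B) i j
  sandwich-linear₃ A B X X₁ X₂ X₃ x y z X≈ i j = trans
    (sandwich-linear A B X X₁₂ X₃ 1# z (λ i j → trans (X≈ i j) (+-congʳ (sym (*-identityˡ _)))) i j)
    (+-congʳ (trans (*-identityˡ _) (sandwich-linear A B X₁₂ X₁ X₂ x y (λ _ _ → refl) i j)))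
    where
    X₁₂ : Matrix _
    X₁₂ i j = x * X₁ i j + y * X₂ i j

  I⊗-sandwich : ∀ {n ν} (A B : Matrix ν) (Y : Matrix (n ℕ.* ν)) u u′ v v′ →
                (((I {n} ⊗ A) · Y) · (I {n} ⊗ B)) (combine u v) (combine u′ v′) ≈ ((A · block Y u u′) · B) v v′
  I⊗-sandwich {n} {ν} A B Y u u′ v v′ = trans (·-I⊗ {n} {ν} ((I {n} ⊗ A) · Y) B u u′ v v′)
    (Σᶠ-cong {ν} {f = λ x → ((I {n} ⊗ A) · Y) (combine u v) (combine u′ x) * B x v′} λ x → *-congʳ (I⊗-· {n} {ν} A Y u u′ v x))

  det-I⊗-inverse : ∀ {n ν} (A B : Matrix ν) → (A · B) ≈ᴹ I → det (I {n} ⊗ A) * det (I {n} ⊗ B) ≈ 1#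
  det-I⊗-inverse {n} {ν} A B AB≈I = begin
    det (I {n} ⊗ A) * det (I {n} ⊗ B)   ≈⟨ det-· (I {n} ⊗ A) (I {n} ⊗ B) ⟨
    det ((I {n} ⊗ A) · (I {n} ⊗ B))         ≈⟨ det-cong (≈ᴹ-combine product≈I) ⟩
    det (I {n ℕ.* ν})               ≈⟨ det-identity {n ℕ.* ν} ⟩
    1#                              ∎
    where
    product≈I : ∀ u u′ v v′ → ((I {n} ⊗ A) · (I {n} ⊗ B)) (combine u v) (combine u′ v′) ≈ δ (combine u v) (combine u′ v′)
    product≈I u u′ v v′ = begin
      ((I {n} ⊗ A) · (I {n} ⊗ B)) (combine u v) (combine u′ v′)  ≈⟨ I⊗-· {n} {ν} A (I {n} ⊗ B) u u′ v v′ ⟩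
      Σᶠ (λ x → A v x * (I {n} ⊗ B) (combine u x) (combine u′ v′))
                                                         ≈⟨ Σᶠ-cong (λ x → *-congˡ (reflexive (⊗-combine (I {n}) B u u′ x v′))) ⟩
      Σᶠ (λ x → A v x * (δ u u′ * B x v′))               ≈⟨ Σᶠ-cong (λ x → solve 3 (λ a d b → a :* (d :* b) := d :* (a :* b))
                                                                                  refl (A v x) (δ u u′) (B x v′)) ⟩
      Σᶠ (λ x → δ u u′ * (A v x * B x v′))               ≈⟨ *-distribˡ-Σᶠ (δ u u′) (λ x → A v x * B x v′) ⟨
      δ u u′ * (A · B) v v′                              ≈⟨ *-congˡ (AB≈I v v′) ⟩
      δ u u′ * δ v v′                                    ≈⟨ δ-combine u u′ v v′ ⟨
      δ (combine u v) (combine u′ v′)                    ∎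

  charMatrix : ∀ {m} → Matrix m → Matrix m → Carrier → Carrier → Matrix m
  charMatrix A D λ′ μ = (λ′ ∙ᴹ I) -ᴹ (A -ᴹ (μ ∙ᴹ D))

module GraphBundle {c ℓ} (R : CommutativeRing c ℓ) {n ν} (G : SimpleGraph n) (F : SimpleGraph ν)
                   (φ : Fin n → Fin n → Permutation′ ν) where
  open WithRing R
  open CommutativeRing R hiding (Carrier; _≈_; _+_; _*_; -_; _-_; 0#; 1#; zero)
  open LinearAlgebra R
  open IntegerCoefficientSolver R using (solve; _:+_; _:*_; :-_; _:-_; _:=_)
  open import Algebra.Properties.Ring ring using (-‿distribˡ-*)
  open import Relation.Binary.Reasoning.Setoid setoid

  fromBool-∧ : ∀ a b → fromBool (a ∧ b) ≈ fromBool a * fromBool b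
  fromBool-∧ true  b = sym (*-identityˡ _)
  fromBool-∧ false b = sym (zeroˡ _)

  fromBool-∨ : ∀ a b → (a ≡ true → b ≡ false) → fromBool (a ∨ b) ≈ fromBool a + fromBool b
  fromBool-∨ true  b disjoint rewrite disjoint ≡.refl = sym (+-identityʳ 1#)
  fromBool-∨ false b disjoint = sym (+-identityˡ _)

  fromℕ-count : ∀ {m} (g : Fin m → Bool) → fromℕ (count g) ≈ Σᶠ (λ i → fromBool (g i))
  fromℕ-count {zero}  g = refl
  fromℕ-count {suc m} g with g zero
  ... | true  = +-congˡ (fromℕ-count (g ∘ suc))
  ... | false = trans (fromℕ-count (g ∘ suc)) (sym (+-identityˡ _))

  P-rowSum : ∀ (γ : Permutation′ ν) v → Σᶠ (P γ v) ≈ 1#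
  P-rowSum γ v = trans (Σᶠ-cong {ν} (λ v′ → sym (*-identityʳ (P γ v v′)))) (Σᶠ-δˡ (γ ⟨$⟩ʳ v) (λ _ → 1#))

  adjacent⇒≢ : ∀ {u u′} → adj G u u′ ≡ true → u ≢ u′
  adjacent⇒≢ {u} uu′ ≡.refl = contradiction (≡.trans (≡.sym uu′) (irrefl G u)) λ ()

  bundle-adjacency : ∀ u u′ v v′ →
    fromBool (bundleAdjFin G F φ (combine u v) (combine u′ v′))
      ≈ fromBool (adj G u u′) * P (φ u u′) v v′ + δ u u′ * adjMatB (adj F) v v′
  bundle-adjacency u u′ v v′ = begin
    fromBool (bundleAdjFin G F φ (combine u v) (combine u′ v′))
      ≡⟨ ≡.cong fromBool (≡.cong₂ (bundleAdj G F φ) (Fin.remQuot-combine u v) (Fin.remQuot-combine u′ v′)) ⟩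
    fromBool ((adj G u u′ ∧ ⌊ v′ ≟ φ u u′ ⟨$⟩ʳ v ⌋) ∨ (⌊ u ≟ u′ ⌋ ∧ adj F v v′))
      ≈⟨ fromBool-∨ _ _ (λ arc → ≡.cong (_∧ adj F v v′) (≟-false (adjacent⇒≢ (∧-conicalˡ _ _ arc)))) ⟩
    fromBool (adj G u u′ ∧ ⌊ v′ ≟ φ u u′ ⟨$⟩ʳ v ⌋) + fromBool (⌊ u ≟ u′ ⌋ ∧ adj F v v′)
      ≈⟨ +-cong (fromBool-∧ _ _) (fromBool-∧ _ _) ⟩
    fromBool (adj G u u′) * δ v′ (φ u u′ ⟨$⟩ʳ v) + δ u u′ * adjMatB (adj F) v v′
      ≡⟨ ≡.cong (λ x → fromBool (adj G u u′) * x + δ u u′ * adjMatB (adj F) v v′) (δ-sym _ _) ⟩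
    fromBool (adj G u u′) * P (φ u u′) v v′ + δ u u′ * adjMatB (adj F) v v′ ∎

  bundleCharMatrix : Carrier → Carrier → Matrix (n ℕ.* ν)
  bundleCharMatrix = charMatrix (adjMatB (bundleAdjFin G F φ)) (degMatB (bundleAdjFin G F φ))

  module _ (r : ℕ) (regular : Regular r F) where

    bundle-degree : ∀ u v → fromℕ (count (bundleAdjFin G F φ (combine u v))) ≈ fromℕ (deg G u) + fromℕ r
    bundle-degree u v = begin
      fromℕ (count (e (combine u v)))                     ≈⟨ fromℕ-count (e (combine u v)) ⟩
      Σᶠ (λ b → fromBool (e (combine u v) b))             ≈⟨ Σᶠ-combine n {ν} _ ⟩
      Σᶠ {n} (λ u′ → Σᶠ {ν} (λ v′ → fromBool (e (combine u v) (combine u′ v′))))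
        ≈⟨ Σᶠ-cong {n} (λ u′ → Σᶠ-linear _ _ (bundle-adjacency u u′ v)) ⟩
      Σᶠ (λ u′ → aG u′ * Σᶠ (P (φ u u′) v) + δ u u′ * Σᶠ (adjMatB (adj F) v))
        ≈⟨ Σᶠ-cong (λ u′ → +-cong (*-congˡ (P-rowSum (φ u u′) v)) (*-congˡ F-rowSum)) ⟩
      Σᶠ (λ u′ → aG u′ * 1# + δ u u′ * fromℕ r)           ≈⟨ Σᶠ-distrib-+ (λ u′ → aG u′ * 1#) (λ u′ → δ u u′ * fromℕ r) ⟩
      Σᶠ (λ u′ → aG u′ * 1#) + Σᶠ (λ u′ → δ u u′ * fromℕ r)
        ≈⟨ +-cong (trans (Σᶠ-cong (λ u′ → *-identityʳ (aG u′))) (sym (fromℕ-count (adj G u))))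
                  (Σᶠ-δˡ u (λ _ → fromℕ r)) ⟩
      fromℕ (deg G u) + fromℕ r                          ∎
      where
      e : Fin (n ℕ.* ν) → Fin (n ℕ.* ν) → Bool
      e = bundleAdjFin G F φ
      aG : Fin n → Carrier
      aG u′ = fromBool (adj G u u′)
      F-rowSum : Σᶠ (adjMatB (adj F) v) ≈ fromℕ r
      F-rowSum = trans (sym (fromℕ-count (adj F v))) (reflexive (≡.cong fromℕ (regular v)))

    bundleCharMatrix-block : ∀ λ′ μ u u′ v v′ →
      block (bundleCharMatrix λ′ μ) u u′ v v′
        ≈ (δ u u′ * (λ′ + μ * (fromℕ (deg G u) + fromℕ r))) * I v v′
          + (- fromBool (adj G u u′)) * P (φ u u′) v v′ + (- δ u u′) * adjMatB (adj F) v v′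
    bundleCharMatrix-block λ′ μ u u′ v v′ = begin
      λ′ * δ (combine u v) (combine u′ v′)
        - (fromBool (e (combine u v) (combine u′ v′)) - μ * (δ (combine u v) (combine u′ v′) * fromℕ (count (e (combine u v)))))
        ≈⟨ +-cong (*-congˡ (δ-combine u u′ v v′))
                  (-‿cong (+-cong (bundle-adjacency u u′ v v′)
                                  (-‿cong (*-congˡ (*-cong (δ-combine u u′ v v′) (bundle-degree u v)))))) ⟩
      λ′ * (δ u u′ * δ v v′) - ((aG * p + δ u u′ * a) - μ * ((δ u u′ * δ v v′) * (fromℕ (deg G u) + fromℕ r)))
        ≈⟨ solve 8 (λ l du dv g p a m d → l :* (du :* dv) :- ((g :* p :+ du :* a) :- m :* ((du :* dv) :* d))
                                        := (du :* (l :+ m :* d)) :* dv :+ (:- g) :* p :+ (:- du) :* a)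
                 refl λ′ (δ u u′) (δ v v′) aG p a μ (fromℕ (deg G u) + fromℕ r) ⟩
      (δ u u′ * (λ′ + μ * (fromℕ (deg G u) + fromℕ r))) * δ v v′ + (- aG) * p + (- δ u u′) * a ∎
      where
      e : Fin (n ℕ.* ν) → Fin (n ℕ.* ν) → Bool
      e = bundleAdjFin G F φ
      aG p a : Carrier
      aG = fromBool (adj G u u′)
      p  = P (φ u u′) v v′
      a  = adjMatB (adj F) v v′

    module Diagonalised (Γ : Permutation′ ν → Set) (voltage : IsVoltage G Γ φ)
                         (M M⁻¹ : Matrix ν) (M⁻¹M≈I : (M⁻¹ · M) ≈ᴹ I)
                         (λΓ : Permutation′ ν → Fin ν → Carrier) (diagΓ : ∀ γ → Γ γ → ((M⁻¹ · P γ) · M) ≈ᴹ diag (λΓ γ))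
                         (λF : Fin ν → Carrier) (diagF : ((M⁻¹ · adjMatB (adj F)) · M) ≈ᴹ diag λF) where

      -- The matrix whose determinant is F-ω G φ λΓ v ((λ′ + r μ) - λF v) μ.
      weightedBlock : Carrier → Carrier → Fin ν → Matrix n
      weightedBlock λ′ μ v = charMatrix (A-weighted G (λ u w → λΓ (φ u w) v)) (diag (λ u → fromℕ (deg G u)))
                                        ((λ′ + fromℕ r * μ) - λF v) μ

      -- Off the arcs of G⃗ the voltage is meaningless, but its coefficient vanishes.
      voltage-term : ∀ u u′ v v′ →
        fromBool (adj G u u′) * ((M⁻¹ · P (φ u u′)) · M) v v′ ≈ δ v v′ * (if adj G u u′ then λΓ (φ u u′) v else 0#)
      voltage-term u u′ v v′ with adj G u u′ in arc
      ... | true  = trans (*-identityˡ _) (diagΓ (φ u u′) (IsVoltage.inΓ voltage u u′ arc) v v′)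
      ... | false = trans (zeroˡ _) (sym (zeroʳ _))

      conjugated-block : ∀ λ′ μ u u′ v v′ →
        (((I {n} ⊗ M⁻¹) · bundleCharMatrix λ′ μ) · (I {n} ⊗ M)) (combine u v) (combine u′ v′) ≈ δ v v′ * weightedBlock λ′ μ v u u′
      conjugated-block λ′ μ u u′ v v′ = begin
        (((I {n} ⊗ M⁻¹) · Y) · (I {n} ⊗ M)) (combine u v) (combine u′ v′)
          ≈⟨ I⊗-sandwich M⁻¹ M Y u u′ v v′ ⟩
        ((M⁻¹ · block Y u u′) · M) v v′
          ≈⟨ sandwich-linear₃ M⁻¹ M (block Y u u′) I (P (φ u u′)) (adjMatB (adj F)) α (- aG) (- δ u u′)
                              (bundleCharMatrix-block λ′ μ u u′) v v′ ⟩
        α * ((M⁻¹ · I) · M) v v′ + (- aG) * ((M⁻¹ · P (φ u u′)) · M) v v′ + (- δ u u′) * ((M⁻¹ · adjMatB (adj F)) · M) v v′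
          ≈⟨ +-cong (+-cong (*-congˡ (trans (·-cong {B = M} (·-identityʳ M⁻¹) (λ _ _ → refl) v v′) (M⁻¹M≈I v v′)))
                            (trans (sym (-‿distribˡ-* _ _)) (-‿cong (voltage-term u u′ v v′))))
                    (*-congˡ (diagF v v′)) ⟩
        α * δ v v′ + - (δ v v′ * w) + (- δ u u′) * (δ v v′ * λF v)
          ≈⟨ solve 8 (λ du l m d r dv w f → (du :* (l :+ m :* (d :+ r))) :* dv :+ :- (dv :* w) :+ (:- du) :* (dv :* f)
                                            := dv :* (((l :+ r :* m) :- f) :* du :- (w :- m :* (du :* d))))
                   refl (δ u u′) λ′ μ (fromℕ (deg G u)) (fromℕ r) (δ v v′) w (λF v) ⟩
        δ v v′ * weightedBlock λ′ μ v u u′ ∎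
        where
        Y : Matrix (n ℕ.* ν)
        Y = bundleCharMatrix λ′ μ
        aG α w : Carrier
        aG = fromBool (adj G u u′)
        α  = δ u u′ * (λ′ + μ * (fromℕ (deg G u) + fromℕ r))
        w  = if adj G u u′ then λΓ (φ u u′) v else 0#

theorem3p8 : ∀ {c ℓ} (R : CommutativeRing c ℓ) →
    let open WithRing R in
    ∀ {n ν : ℕ} (G : SimpleGraph n) (F : SimpleGraph ν) (r : ℕ) →
    Connected G → Connected F → Regular r F →
    (Γ : Permutation′ ν → Set) → IsAbelianSubgroupOfAut F Γ →
    (φ : Fin n → Fin n → Permutation′ ν) → IsVoltage G Γ φ →
    (M M⁻¹ : Matrix ν) → (M⁻¹ · M) ≈ᴹ I → (M · M⁻¹) ≈ᴹ I →
    (λΓ : Permutation′ ν → Fin ν → Carrier) →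
    (∀ γ → Γ γ → ((M⁻¹ · P γ) · M) ≈ᴹ diag (λΓ γ)) →
    (λF : Fin ν → Carrier) →
    ((M⁻¹ · adjMatB (adj F)) · M) ≈ᴹ diag λF →
    ∀ (λ' μ : Carrier) →
    F-bundle G F φ λ' μ
      ≈ Πᶠ (λ i → F-ω G φ λΓ i ((λ' + fromℕ r * μ) - λF i) μ)
theorem3p8 R {n} {ν} G F r _ _ regular Γ _ φ voltage M M⁻¹ M⁻¹M≈I _ λΓ diagΓ λF diagF λ′ μ = begin
  det Y                                ≈⟨ det-sandwich (I {n} ⊗ M⁻¹) (I {n} ⊗ M) Y (det-I⊗-inverse {n} M⁻¹ M M⁻¹M≈I) ⟨
  det Z                                ≈⟨ det-permute (swapFactors {ν} {n}) Z ⟨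
  det (λ c d → Z (σ c) (σ d))          ≈⟨ det-blockDiagonal ν (weightedBlock λ′ μ) (λ c d → Z (σ c) (σ d)) blockDiagonal ⟩
  Πᶠ (λ v → det (weightedBlock λ′ μ v)) ∎
  where
  open WithRing R
  open LinearAlgebra R
  open GraphBundle R G F φ
  open Diagonalised r regular Γ voltage M M⁻¹ M⁻¹M≈I λΓ diagΓ λF diagF
  open CommutativeRing R using (setoid; trans; reflexive)
  open SetoidReasoning setoid
  Y Z : Matrix (n ℕ.* ν)
  Y = bundleCharMatrix λ′ μ
  Z = ((I {n} ⊗ M⁻¹) · Y) · (I {n} ⊗ M)
  σ : Fin (ν ℕ.* n) → Fin (n ℕ.* ν)
  σ = swapFactors {ν} {n} ⟨$⟩ʳ_
  blockDiagonal : ∀ v v′ u u′ → Z (σ (combine v u)) (σ (combine v′ u′)) ≈ δ v v′ * weightedBlock λ′ μ v u u′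
  blockDiagonal v v′ u u′ = trans (reflexive (≡.cong₂ Z (swapFactors-combine v u) (swapFactors-combine v′ u′)))
                                  (conjugated-block λ′ μ u u′ v v′)
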